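{- Let $d\geq 1$, $i,j\geq 0$, $I=[i,i+d-1]$ and $J=[j,j+d-1]$. Then $b^I_J=b^{I\setminus (I\cap J)}_{J\setminus (I\cap J)}$.
   Context: For integers $p,q\geq 0$, $b_{p,q}=\binom{p}{q}$, with $b_{p,q}=0$ if $q>p$. For $k\leq l$, $[k,l]=\{k,\ldots,l\}$. For finite sets $I=\{i_1<\cdots<i_m\}$, $J=\{j_1<\cdots<j_m\}$ of non-negative integers of equal cardinality, $b^I_J$ is the determinant of the $m\times m$ matrix with $(r,s)$ entry $b_{i_r,j_s}$ (the empty determinant being $1$). Note $I\setminus(I\cap J)$ and $J\setminus(I\cap J)$ have the same cardinality. -}

module Defs where

open import Data.Nat using (ℕ; zero; suc; _+_)
open import Data.Nat.Combinatorics using (_C_)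
open import Data.Fin using (Fin; zero; suc; toℕ; punchIn; cast)
open import Data.Integer using (ℤ; +_; -_; _*_) renaming (_+_ to _+ℤ_)
open import Data.List using (List; []; _∷_; length; lookup; filter; map; upTo)
open import Data.List.Membership.DecPropositional (Data.Nat._≟_) using (_∉?_)
open import Relation.Binary.PropositionalEquality using (_≡_; trans; sym)
open import Data.List.Properties using (length-map; length-upTo)

b : ℕ → ℕ → ℤ
b p q = + (p C q)

sumFin : ∀ {m} → (Fin m → ℤ) → ℤ
sumFin {zero}  f = + 0
sumFin {suc m} f = f zero +ℤ sumFin (λ k → f (suc k))

sgn : ℕ → ℤ
sgn zero = + 1
sgn (suc n) = - sgn n

det : ∀ {m} → (Fin m → Fin m → ℤ) → ℤ
det {zero}  M = + 1
det {suc m} M =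
  sumFin (λ s → sgn (toℕ s) * (M zero s * det (λ r c → M (suc r) (punchIn s c))))

-- finite sets of naturals are represented as strictly increasing lists.
-- [k, k+d-1] as the increasing list k, k+1, ..., k+d-1
interval : ℕ → ℕ → List ℕ
interval k d = map (λ t → k + t) (upTo d)

_∖_ : List ℕ → List ℕ → List ℕ
X ∖ Y = filter (_∉? Y) X

bDet : (I J : List ℕ) → length I ≡ length J → ℤ
bDet I J e = det (λ r s → b (lookup I r) (lookup J (cast e s)))

interval-len : ∀ i j d → length (interval i d) ≡ length (interval j d)
interval-len i j d = trans (trans (length-map (λ t → i + t) (upTo d)) (length-upTo d))
                           (sym (trans (length-map (λ t → j + t) (upTo d)) (length-upTo d)))

{-# OPTIONS --safe #-}
module Submission where

-- Write P for the Pascal matrix (b_{z+r, z+c}).  If I and J are disjoint there is nothing to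
-- prove.  If I starts before J, the first row of both determinants consists of binomials
-- b_{i,q} with q > i, so both vanish.  If J = [z, z+k+m) and I = [z+k, z+2k+m), then
-- I ∖ J = [z+k+m, z+2k+m) and J ∖ I = [z, z+k), and the identity says that the d×d minor of P
-- on rows k, ..., k+d-1 equals the k×k minor on rows d, ..., d+k-1 (d = k+m).  This is Jacobi's
-- complementary-minor theorem for P, whose inverse ((-1)^{r+c} b_{z+r, z+c}) is unitriangular;
-- the inverse is computed from the trinomial revision b_{p,q} b_{q,m} = b_{p,m} b_{p-m, q-m}
-- and the alternating sum of binomials.

open import Defs
open import Function using (_∘_; id)
open import Data.Nat using (ℕ; zero; suc; _+_; _*_; _∸_; _≤_; _<_; z≤n; s≤s; _<?_; _≤?_; _!; NonZero)
open import Data.Nat.Properties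
  using ( suc-injective; _≟_; ≤-refl; ≤-reflexive; ≤-trans; ≤-antisym; <-trans; <-≤-trans; ≤-<-trans; <-cmp
        ; <⇒≤; <⇒≢; <⇒≱; ≰⇒>; ≤∧≢⇒<; <-≤-connex; n<1+n; m<n⇒m<1+n; m≤m+n; m≤n+m; m≤n⇒∃[o]m+o≡n
        ; +-identityʳ; +-suc; +-assoc; +-comm; +-monoʳ-<; +-monoʳ-≤; +-cancelˡ-≤; +-cancelˡ-<
        ; *-suc; *-zeroʳ; *-cancelʳ-≡; m*n≢0; _!≢0; _!*_!≢0
        ; m+n∸m≡n; m+[n∸m]≡n; [m+n]∸[m+o]≡n∸o; n∸n≡0; m∸n≡0⇒m≤n; ∸-monoˡ-< )
open import Data.Nat.Combinatorics using (_C_; nCk≡n!/k![n-k]!; k![n∸k]!∣n!; k>n⇒nCk≡0; nCn≡1; nCk+nC[k+1]≡[n+1]C[k+1])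
open import Data.Nat.DivMod using (_/_; m/n*n≡m)
open import Data.Nat.Tactic.RingSolver using () renaming (solve-∀ to ℕ-solve-∀)
open import Data.Integer using (ℤ; +_; -_; -[1+_]; _-_) renaming (_+_ to _+ℤ_; _*_ to _*ℤ_)
import Data.Integer.Properties as ℤₚ
open import Data.Integer.Tactic.RingSolver using (solve-∀)
open import Data.Fin as Fin using (Fin; toℕ)
open import Data.Fin.Properties using (toℕ-cast)
open import Data.List using ([]; _∷_; _++_; map; upTo; applyUpTo; length; lookup)
open import Data.List.Properties using (map-upTo; map-cong; filter-all; filter-none; filter-++; ++-identityʳ; length-applyUpTo; lookup-applyUpTo)
open import Data.List.Membership.DecPropositional (Data.Nat._≟_) using (_∈_; _∉_; _∉?_)
open import Data.List.Membership.Propositional.Properties using (∈-map⁺; ∈-map⁻; ∈-upTo⁺; ∈-upTo⁻)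
import Data.List.Relation.Unary.All.Properties as All
open import Data.Product using (Σ; _,_)
open import Data.Sum as Sum using (_⊎_; inj₁; inj₂)
open import Data.Empty using (⊥-elim)
open import Relation.Nullary using (yes; no)
open import Relation.Binary.Definitions using (tri<; tri≈; tri>)
open import Relation.Binary.PropositionalEquality using (_≡_; _≢_; refl; sym; trans; cong; cong₂; subst; module ≡-Reasoning)
open ≡-Reasoning

∑ : ℕ → (ℕ → ℤ) → ℤ
∑ zero    f = + 0
∑ (suc n) f = f 0 +ℤ ∑ n (f ∘ suc)

∏ : ℕ → (ℕ → ℤ) → ℤ
∏ zero    f = + 1
∏ (suc n) f = f 0 *ℤ ∏ n (f ∘ suc)

∑-cong : ∀ n {f g : ℕ → ℤ} → (∀ i → i < n → f i ≡ g i) → ∑ n f ≡ ∑ n g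
∑-cong zero    f≗g = refl
∑-cong (suc n) f≗g = cong₂ _+ℤ_ (f≗g 0 (s≤s z≤n)) (∑-cong n (λ i i<n → f≗g (suc i) (s≤s i<n)))

∑-zero : ∀ n {f : ℕ → ℤ} → (∀ i → i < n → f i ≡ + 0) → ∑ n f ≡ + 0
∑-zero zero    f≗0 = refl
∑-zero (suc n) f≗0 = cong₂ _+ℤ_ (f≗0 0 (s≤s z≤n)) (∑-zero n (λ i i<n → f≗0 (suc i) (s≤s i<n)))

∑-distrib-+ : ∀ n (f g : ℕ → ℤ) → ∑ n (λ i → f i +ℤ g i) ≡ ∑ n f +ℤ ∑ n g
∑-distrib-+ zero    f g = refl
∑-distrib-+ (suc n) f g = begin
  f 0 +ℤ g 0 +ℤ ∑ n (λ i → f (suc i) +ℤ g (suc i)) ≡⟨ cong (f 0 +ℤ g 0 +ℤ_) (∑-distrib-+ n (f ∘ suc) (g ∘ suc)) ⟩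
  f 0 +ℤ g 0 +ℤ (∑ n (f ∘ suc) +ℤ ∑ n (g ∘ suc))   ≡⟨ interchange (f 0) (g 0) _ _ ⟩
  f 0 +ℤ ∑ n (f ∘ suc) +ℤ (g 0 +ℤ ∑ n (g ∘ suc))   ∎
  where interchange : ∀ a b c d → a +ℤ b +ℤ (c +ℤ d) ≡ a +ℤ c +ℤ (b +ℤ d)
        interchange = solve-∀

*-distribˡ-∑ : ∀ n a (f : ℕ → ℤ) → ∑ n (λ i → a *ℤ f i) ≡ a *ℤ ∑ n f
*-distribˡ-∑ zero    a f = sym (ℤₚ.*-zeroʳ a)
*-distribˡ-∑ (suc n) a f =
  trans (cong (a *ℤ f 0 +ℤ_) (*-distribˡ-∑ n a (f ∘ suc))) (sym (ℤₚ.*-distribˡ-+ a (f 0) _))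

neg-distrib-∑ : ∀ n (f : ℕ → ℤ) → ∑ n (λ i → - f i) ≡ - ∑ n f
neg-distrib-∑ zero    f = refl
neg-distrib-∑ (suc n) f = trans (cong (- f 0 +ℤ_) (neg-distrib-∑ n (f ∘ suc))) (sym (ℤₚ.neg-distrib-+ (f 0) _))

∑-split : ∀ m n (f : ℕ → ℤ) → ∑ (m + n) f ≡ ∑ m f +ℤ ∑ n (λ i → f (m + i))
∑-split zero    n f = sym (ℤₚ.+-identityˡ _)
∑-split (suc m) n f = trans (cong (f 0 +ℤ_) (∑-split m n (f ∘ suc))) (sym (ℤₚ.+-assoc (f 0) _ _))

∑-last : ∀ n (f : ℕ → ℤ) → ∑ (suc n) f ≡ ∑ n f +ℤ f n
∑-last zero    f = trans (ℤₚ.+-identityʳ (f 0)) (sym (ℤₚ.+-identityˡ (f 0)))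
∑-last (suc n) f = trans (cong (f 0 +ℤ_) (∑-last n (f ∘ suc))) (sym (ℤₚ.+-assoc (f 0) _ _))

δ : ℕ → ℕ → ℤ
δ zero    zero    = + 1
δ zero    (suc n) = + 0
δ (suc m) zero    = + 0
δ (suc m) (suc n) = δ m n

δ-refl : ∀ n → δ n n ≡ + 1
δ-refl zero    = refl
δ-refl (suc n) = δ-refl n

δ-≢ : ∀ {m n} → m ≢ n → δ m n ≡ + 0
δ-≢ {zero}  {zero}  m≢n = ⊥-elim (m≢n refl)
δ-≢ {zero}  {suc n} _   = refl
δ-≢ {suc m} {zero}  _   = refl
δ-≢ {suc m} {suc n} m≢n = δ-≢ (m≢n ∘ cong suc)

∑-single : ∀ n c (f : ℕ → ℤ) → c < n → (∀ i → i < n → i ≢ c → f i ≡ + 0) → ∑ n f ≡ f c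
∑-single (suc n) zero f _ others = begin
  f 0 +ℤ ∑ n (f ∘ suc) ≡⟨ cong (f 0 +ℤ_) (∑-zero n (λ i i<n → others (suc i) (s≤s i<n) λ ())) ⟩
  f 0 +ℤ + 0           ≡⟨ ℤₚ.+-identityʳ (f 0) ⟩
  f 0                  ∎
∑-single (suc n) (suc c) f (s≤s c<n) others = begin
  f 0 +ℤ ∑ n (f ∘ suc) ≡⟨ cong₂ _+ℤ_ (others 0 (s≤s z≤n) λ ()) rest ⟩
  + 0 +ℤ f (suc c)     ≡⟨ ℤₚ.+-identityˡ _ ⟩
  f (suc c)            ∎
  where rest = ∑-single n c (f ∘ suc) c<n (λ i i<n i≢c → others (suc i) (s≤s i<n) (i≢c ∘ suc-injective))

∑-δ : ∀ n c (f : ℕ → ℤ) → c < n → ∑ n (λ i → δ i c *ℤ f i) ≡ f c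
∑-δ n c f c<n = begin
  ∑ n (λ i → δ i c *ℤ f i) ≡⟨ ∑-single n c _ c<n (λ i _ i≢c → trans (cong (_*ℤ f i) (δ-≢ i≢c)) (ℤₚ.*-zeroˡ (f i))) ⟩
  δ c c *ℤ f c             ≡⟨ cong (_*ℤ f c) (δ-refl c) ⟩
  + 1 *ℤ f c               ≡⟨ ℤₚ.*-identityˡ (f c) ⟩
  f c                      ∎

∑-sub-δ : ∀ n t (a y : ℕ → ℤ) → t < n → ∑ n (λ i → (a i - δ i t) *ℤ y i) ≡ ∑ n (λ i → a i *ℤ y i) - y t
∑-sub-δ n t a y t<n = begin
  ∑ n (λ i → (a i - δ i t) *ℤ y i)                          ≡⟨ ∑-cong n (λ i _ → distrib (a i) (δ i t) (y i)) ⟩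
  ∑ n (λ i → a i *ℤ y i +ℤ - (δ i t *ℤ y i))                ≡⟨ ∑-distrib-+ n (λ i → a i *ℤ y i) _ ⟩
  ∑ n (λ i → a i *ℤ y i) +ℤ ∑ n (λ i → - (δ i t *ℤ y i))    ≡⟨ cong (∑ n (λ i → a i *ℤ y i) +ℤ_) (neg-distrib-∑ n (λ i → δ i t *ℤ y i)) ⟩
  ∑ n (λ i → a i *ℤ y i) - ∑ n (λ i → δ i t *ℤ y i)         ≡⟨ cong (λ z → ∑ n (λ i → a i *ℤ y i) - z) (∑-δ n t y t<n) ⟩
  ∑ n (λ i → a i *ℤ y i) - y t                              ∎
  where distrib : ∀ a d y → (a - d) *ℤ y ≡ a *ℤ y +ℤ - (d *ℤ y)
        distrib = solve-∀

∏-cong : ∀ n {f g : ℕ → ℤ} → (∀ i → f i ≡ g i) → ∏ n f ≡ ∏ n g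
∏-cong zero    f≗g = refl
∏-cong (suc n) f≗g = cong₂ _*ℤ_ (f≗g 0) (∏-cong n (f≗g ∘ suc))

∏-distrib-* : ∀ n (f g : ℕ → ℤ) → ∏ n (λ i → f i *ℤ g i) ≡ ∏ n f *ℤ ∏ n g
∏-distrib-* zero    f g = refl
∏-distrib-* (suc n) f g =
  trans (cong (f 0 *ℤ g 0 *ℤ_) (∏-distrib-* n (f ∘ suc) (g ∘ suc))) (interchange (f 0) (g 0) _ _)
  where interchange : ∀ a b c d → a *ℤ b *ℤ (c *ℤ d) ≡ a *ℤ c *ℤ (b *ℤ d)
        interchange = solve-∀

sgn-+ : ∀ m n → sgn (m + n) ≡ sgn m *ℤ sgn n
sgn-+ zero    n = sym (ℤₚ.*-identityˡ (sgn n))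
sgn-+ (suc m) n = trans (cong -_ (sgn-+ m n)) (ℤₚ.neg-distribˡ-* (sgn m) (sgn n))

sgn-square : ∀ n → sgn n *ℤ sgn n ≡ + 1
sgn-square zero    = refl
sgn-square (suc n) = trans (neg-square (sgn n)) (sgn-square n)
  where neg-square : ∀ a → (- a) *ℤ (- a) ≡ a *ℤ a
        neg-square = solve-∀

sgn-double : ∀ n → sgn (n + n) ≡ + 1
sgn-double n = trans (sgn-+ n n) (sgn-square n)

∏-sgn : ∀ d k → ∏ k (λ i → sgn (d + i)) *ℤ ∏ k sgn ≡ sgn (d * k)
∏-sgn d k = begin
  ∏ k (λ i → sgn (d + i)) *ℤ ∏ k sgn ≡⟨ sym (∏-distrib-* k (λ i → sgn (d + i)) sgn) ⟩
  ∏ k (λ i → sgn (d + i) *ℤ sgn i)   ≡⟨ ∏-cong k sgn-shift ⟩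
  ∏ k (λ _ → sgn d)                  ≡⟨ ∏-const k ⟩
  sgn (d * k)                        ∎
  where
  sgn-shift : ∀ i → sgn (d + i) *ℤ sgn i ≡ sgn d
  sgn-shift i = begin
    sgn (d + i) *ℤ sgn i      ≡⟨ cong (_*ℤ sgn i) (sgn-+ d i) ⟩
    sgn d *ℤ sgn i *ℤ sgn i   ≡⟨ ℤₚ.*-assoc (sgn d) (sgn i) (sgn i) ⟩
    sgn d *ℤ (sgn i *ℤ sgn i) ≡⟨ cong (sgn d *ℤ_) (sgn-square i) ⟩
    sgn d *ℤ + 1              ≡⟨ ℤₚ.*-identityʳ (sgn d) ⟩
    sgn d                     ∎
  ∏-const : ∀ k → ∏ k (λ _ → sgn d) ≡ sgn (d * k)
  ∏-const zero    = cong sgn (sym (*-zeroʳ d))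
  ∏-const (suc k) = begin
    sgn d *ℤ ∏ k (λ _ → sgn d) ≡⟨ cong (sgn d *ℤ_) (∏-const k) ⟩
    sgn d *ℤ sgn (d * k)       ≡⟨ sym (sgn-+ d (d * k)) ⟩
    sgn (d + d * k)            ≡⟨ cong sgn (sym (*-suc d k)) ⟩
    sgn (d * suc k)            ∎

punchIn : ℕ → ℕ → ℕ
punchIn zero    c       = suc c
punchIn (suc s) zero    = zero
punchIn (suc s) (suc c) = suc (punchIn s c)

punchOut : ℕ → ℕ → ℕ
punchOut zero    zero    = zero
punchOut zero    (suc c) = c
punchOut (suc s) zero    = zero
punchOut (suc s) (suc c) = suc (punchOut s c)

punchIn-punchOut : ∀ {s c} → s ≢ c → punchIn s (punchOut s c) ≡ c
punchIn-punchOut {zero}  {zero}  s≢c = ⊥-elim (s≢c refl)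
punchIn-punchOut {zero}  {suc c} s≢c = refl
punchIn-punchOut {suc s} {zero}  s≢c = refl
punchIn-punchOut {suc s} {suc c} s≢c = cong suc (punchIn-punchOut (s≢c ∘ cong suc))

punchInₛ≢s : ∀ s c → punchIn s c ≢ s
punchInₛ≢s zero    c       ()
punchInₛ≢s (suc s) zero    ()
punchInₛ≢s (suc s) (suc c) eq = punchInₛ≢s s c (suc-injective eq)

punchIn-injective : ∀ s c c′ → punchIn s c ≡ punchIn s c′ → c ≡ c′
punchIn-injective zero    c       c′       eq = suc-injective eq
punchIn-injective (suc s) zero    zero     eq = refl
punchIn-injective (suc s) (suc c) (suc c′) eq = cong suc (punchIn-injective s c c′ (suc-injective eq))

punchIn-< : ∀ s c → c < s → punchIn s c ≡ c
punchIn-< (suc s) zero    _         = refl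
punchIn-< (suc s) (suc c) (s≤s c<s) = cong suc (punchIn-< s c c<s)

punchIn-≥ : ∀ s c → s ≤ c → punchIn s c ≡ suc c
punchIn-≥ zero    c       _         = refl
punchIn-≥ (suc s) (suc c) (s≤s s≤c) = cong suc (punchIn-≥ s c s≤c)

punchIn-bounded : ∀ s {c n} → c < n → punchIn s c < suc n
punchIn-bounded zero    c<n             = s≤s c<n
punchIn-bounded (suc s) {zero}  c<n       = s≤s z≤n
punchIn-bounded (suc s) {suc c} (s≤s c<n) = s≤s (punchIn-bounded s c<n)

punchOut-bounded : ∀ {s c n} → s < suc n → c < suc n → s ≢ c → punchOut s c < n
punchOut-bounded {zero}  {zero}  _ _ s≢c = ⊥-elim (s≢c refl)
punchOut-bounded {zero}  {suc c} _ (s≤s c<n) _ = c<n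
punchOut-bounded {suc s} {zero}  {suc n} _ _ _ = s≤s z≤n
punchOut-bounded {suc s} {suc c} {suc n} (s≤s s<n) (s≤s c<n) s≢c =
  s≤s (punchOut-bounded s<n c<n (s≢c ∘ cong suc))
punchOut-bounded {suc s} {zero}  {zero}  (s≤s ()) _ _
punchOut-bounded {suc s} {suc c} {zero}  _ (s≤s ()) _

δ-punchIn : ∀ s c m → s ≤ m → δ (punchIn s c) (suc m) ≡ δ c m
δ-punchIn s c m s≤m with <-≤-connex c s
... | inj₁ c<s = begin
  δ (punchIn s c) (suc m) ≡⟨ cong (λ x → δ x (suc m)) (punchIn-< s c c<s) ⟩
  δ c (suc m)             ≡⟨ δ-≢ (<⇒≢ (<-trans c<m (n<1+n m))) ⟩
  + 0                     ≡⟨ δ-≢ (<⇒≢ c<m) ⟨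
  δ c m                   ∎
  where c<m = <-≤-trans c<s s≤m
... | inj₂ s≤c = cong (λ x → δ x (suc m)) (punchIn-≥ s c s≤c)

∏-punchIn : ∀ n s (f : ℕ → ℤ) → s < suc n → ∏ (suc n) f ≡ f s *ℤ ∏ n (f ∘ punchIn s)
∏-punchIn n       zero    f _ = refl
∏-punchIn (suc n) (suc s) f (s≤s s≤n) =
  trans (cong (f 0 *ℤ_) (∏-punchIn n s (f ∘ suc) s≤n)) (exchange (f 0) (f (suc s)) _)
  where exchange : ∀ a b c → a *ℤ (b *ℤ c) ≡ b *ℤ (a *ℤ c)
        exchange = solve-∀

adjSwap : ℕ → ℕ → ℕ
adjSwap zero    zero          = 1
adjSwap zero    (suc zero)    = 0
adjSwap zero    (suc (suc i)) = suc (suc i)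
adjSwap (suc c) zero          = zero
adjSwap (suc c) (suc i)       = suc (adjSwap c i)

adjSwap-self : ∀ c → adjSwap c c ≡ suc c
adjSwap-self zero    = refl
adjSwap-self (suc c) = cong suc (adjSwap-self c)

adjSwap-suc : ∀ c → adjSwap c (suc c) ≡ c
adjSwap-suc zero    = refl
adjSwap-suc (suc c) = cong suc (adjSwap-suc c)

adjSwap-other : ∀ c i → i ≢ c → i ≢ suc c → adjSwap c i ≡ i
adjSwap-other zero    zero          i≢c _    = ⊥-elim (i≢c refl)
adjSwap-other zero    (suc zero)    _   i≢1  = ⊥-elim (i≢1 refl)
adjSwap-other zero    (suc (suc i)) _   _    = refl
adjSwap-other (suc c) zero          _   _    = refl
adjSwap-other (suc c) (suc i)       i≢c i≢c+1 = cong suc (adjSwap-other c i (i≢c ∘ cong suc) (i≢c+1 ∘ cong suc))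

adjSwap-involutive : ∀ c i → adjSwap c (adjSwap c i) ≡ i
adjSwap-involutive zero    zero          = refl
adjSwap-involutive zero    (suc zero)    = refl
adjSwap-involutive zero    (suc (suc i)) = refl
adjSwap-involutive (suc c) zero          = refl
adjSwap-involutive (suc c) (suc i)       = cong suc (adjSwap-involutive c i)

adjSwap-punchIn-self : ∀ c x → adjSwap c (punchIn c x) ≡ punchIn (suc c) x
adjSwap-punchIn-self zero    zero    = refl
adjSwap-punchIn-self zero    (suc x) = refl
adjSwap-punchIn-self (suc c) zero    = refl
adjSwap-punchIn-self (suc c) (suc x) = cong suc (adjSwap-punchIn-self c x)

adjSwap-punchIn-suc : ∀ c x → adjSwap c (punchIn (suc c) x) ≡ punchIn c x
adjSwap-punchIn-suc zero    zero    = refl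
adjSwap-punchIn-suc zero    (suc x) = refl
adjSwap-punchIn-suc (suc c) zero    = refl
adjSwap-punchIn-suc (suc c) (suc x) = cong suc (adjSwap-punchIn-suc c x)

adjSwap-punchIn : ∀ s c x → s ≢ c → s ≢ suc c → adjSwap c (punchIn s x) ≡ punchIn s (adjSwap (punchOut s c) x)
adjSwap-punchIn zero                zero    x             s≢c _ = ⊥-elim (s≢c refl)
adjSwap-punchIn zero                (suc c) x             _   _ = refl
adjSwap-punchIn (suc zero)          zero    x             _ s≢1 = ⊥-elim (s≢1 refl)
adjSwap-punchIn (suc (suc s))       zero    zero          _   _ = refl
adjSwap-punchIn (suc (suc s))       zero    (suc zero)    _   _ = refl
adjSwap-punchIn (suc (suc s))       zero    (suc (suc x)) _   _ = refl
adjSwap-punchIn (suc s)             (suc c) zero          _   _ = refl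
adjSwap-punchIn (suc s)             (suc c) (suc x) s≢c s≢c+1 =
  cong suc (adjSwap-punchIn s c x (s≢c ∘ cong suc) (s≢c+1 ∘ cong suc))

punchOut-adjacent-bounded : ∀ {s c n} → s < suc n → suc c < suc n → s ≢ c → s ≢ suc c → suc (punchOut s c) < n
punchOut-adjacent-bounded {zero}        {zero}  _ _ s≢c _ = ⊥-elim (s≢c refl)
punchOut-adjacent-bounded {zero}        {suc c} _ (s≤s c<n) _ _ = c<n
punchOut-adjacent-bounded {suc zero}    {zero}  _ _ _ s≢1 = ⊥-elim (s≢1 refl)
punchOut-adjacent-bounded {suc (suc s)} {zero}  {suc (suc n)} _ _ _ _ = s≤s (s≤s z≤n)
punchOut-adjacent-bounded {suc (suc s)} {zero}  {suc zero} (s≤s (s≤s ())) _ _ _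
punchOut-adjacent-bounded {suc (suc s)} {zero}  {zero}     (s≤s ()) _ _ _
punchOut-adjacent-bounded {suc s} {suc c} {suc n} (s≤s s<n) (s≤s c<n) s≢c s≢c+1 =
  s≤s (punchOut-adjacent-bounded s<n c<n (s≢c ∘ cong suc) (s≢c+1 ∘ cong suc))
punchOut-adjacent-bounded {suc s} {suc c} {zero} _ (s≤s ()) _ _

∑-adjSwap : ∀ n c (f : ℕ → ℤ) → suc c < n → ∑ n (f ∘ adjSwap c) ≡ ∑ n f
∑-adjSwap (suc (suc n)) zero    f _ = begin
  f 1 +ℤ (f 0 +ℤ ∑ n (f ∘ suc ∘ suc)) ≡⟨ sym (ℤₚ.+-assoc (f 1) (f 0) _) ⟩
  f 1 +ℤ f 0 +ℤ ∑ n (f ∘ suc ∘ suc)   ≡⟨ cong (_+ℤ ∑ n (f ∘ suc ∘ suc)) (ℤₚ.+-comm (f 1) (f 0)) ⟩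
  f 0 +ℤ f 1 +ℤ ∑ n (f ∘ suc ∘ suc)   ≡⟨ ℤₚ.+-assoc (f 0) (f 1) _ ⟩
  f 0 +ℤ (f 1 +ℤ ∑ n (f ∘ suc ∘ suc)) ∎
∑-adjSwap (suc n) (suc c) f (s≤s c<n) = cong (f 0 +ℤ_) (∑-adjSwap n c (f ∘ suc) c<n)

-- Determinants by Laplace expansion along the first row

-- detℕ n reads only the entries with r, c < n (detℕ-cong), so matrices are total functions on
-- ℕ and the size is an argument of detℕ.
Matrix : Set
Matrix = ℕ → ℕ → ℤ

minor : Matrix → ℕ → Matrix
minor M s r c = M (suc r) (punchIn s c)

detℕ : ℕ → Matrix → ℤ

laplaceTerm : ℕ → Matrix → ℕ → ℤ
laplaceTerm n M s = sgn s *ℤ (M 0 s *ℤ detℕ n (minor M s))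

detℕ zero    M = + 1
detℕ (suc n) M = ∑ (suc n) (laplaceTerm n M)

toℕ-punchIn : ∀ {m} (s : Fin (suc m)) (c : Fin m) → toℕ (Fin.punchIn s c) ≡ punchIn (toℕ s) (toℕ c)
toℕ-punchIn Fin.zero    c           = refl
toℕ-punchIn (Fin.suc s) Fin.zero    = refl
toℕ-punchIn (Fin.suc s) (Fin.suc c) = cong suc (toℕ-punchIn s c)

sumFin≡∑ : ∀ m (f : Fin m → ℤ) (g : ℕ → ℤ) → (∀ s → f s ≡ g (toℕ s)) → sumFin f ≡ ∑ m g
sumFin≡∑ zero    f g f≗g = refl
sumFin≡∑ (suc m) f g f≗g = cong₂ _+ℤ_ (f≗g Fin.zero) (sumFin≡∑ m (f ∘ Fin.suc) (g ∘ suc) (f≗g ∘ Fin.suc))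

det≡detℕ : ∀ m (M′ : Fin m → Fin m → ℤ) (M : Matrix) → (∀ r c → M′ r c ≡ M (toℕ r) (toℕ c)) → det M′ ≡ detℕ m M
det≡detℕ zero    M′ M M′≗M = refl
det≡detℕ (suc m) M′ M M′≗M = sumFin≡∑ (suc m) _ (laplaceTerm m M) λ s →
  cong₂ (λ x y → sgn (toℕ s) *ℤ (x *ℤ y)) (M′≗M Fin.zero s)
    (det≡detℕ m _ (minor M (toℕ s)) λ r c →
      trans (M′≗M (Fin.suc r) (Fin.punchIn s c)) (cong (M (suc (toℕ r))) (toℕ-punchIn s c)))

detℕ-cong : ∀ n {M N : Matrix} → (∀ r c → r < n → c < n → M r c ≡ N r c) → detℕ n M ≡ detℕ n N
detℕ-cong zero    M≗N = refl
detℕ-cong (suc n) M≗N = ∑-cong (suc n) λ s s≤n →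
  cong₂ (λ x y → sgn s *ℤ (x *ℤ y)) (M≗N 0 s (s≤s z≤n) s≤n)
    (detℕ-cong n λ r c r<n c<n → M≗N (suc r) (punchIn s c) (s≤s r<n) (punchIn-bounded s c<n))

detℕ-zero-row : ∀ n r (M : Matrix) → r < n → (∀ c → c < n → M r c ≡ + 0) → detℕ n M ≡ + 0
detℕ-zero-row (suc n) zero M _ row≡0 = ∑-zero (suc n) λ s s≤n → begin
  sgn s *ℤ (M 0 s *ℤ detℕ n (minor M s)) ≡⟨ cong (λ x → sgn s *ℤ (x *ℤ detℕ n (minor M s))) (row≡0 s s≤n) ⟩
  sgn s *ℤ (+ 0 *ℤ detℕ n (minor M s))   ≡⟨ ℤₚ.*-zeroʳ (sgn s) ⟩
  + 0                                    ∎
detℕ-zero-row (suc n) (suc r) M (s≤s r<n) row≡0 = ∑-zero (suc n) λ s _ → begin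
  sgn s *ℤ (M 0 s *ℤ detℕ n (minor M s)) ≡⟨ cong (λ x → sgn s *ℤ (M 0 s *ℤ x)) minor≡0 ⟩
  sgn s *ℤ (M 0 s *ℤ + 0)                ≡⟨ cong (sgn s *ℤ_) (ℤₚ.*-zeroʳ (M 0 s)) ⟩
  sgn s *ℤ + 0                           ≡⟨ ℤₚ.*-zeroʳ (sgn s) ⟩
  + 0                                    ∎
  where minor≡0 = λ {s} → detℕ-zero-row n r (minor M s) r<n (λ c c<n → row≡0 (punchIn s c) (punchIn-bounded s c<n))

detℕ-unit-row : ∀ n c₀ (M : Matrix) → c₀ < suc n → (∀ c → c < suc n → M 0 c ≡ δ c c₀) →
  detℕ (suc n) M ≡ sgn c₀ *ℤ detℕ n (minor M c₀)
detℕ-unit-row n c₀ M c₀≤n row≡δ = begin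
  detℕ (suc n) M                               ≡⟨ ∑-single (suc n) c₀ _ c₀≤n off-c₀ ⟩
  sgn c₀ *ℤ (M 0 c₀ *ℤ detℕ n (minor M c₀))    ≡⟨ cong (λ x → sgn c₀ *ℤ (x *ℤ detℕ n (minor M c₀))) (trans (row≡δ c₀ c₀≤n) (δ-refl c₀)) ⟩
  sgn c₀ *ℤ (+ 1 *ℤ detℕ n (minor M c₀))       ≡⟨ cong (sgn c₀ *ℤ_) (ℤₚ.*-identityˡ _) ⟩
  sgn c₀ *ℤ detℕ n (minor M c₀)                ∎
  where
  off-c₀ : ∀ s → s < suc n → s ≢ c₀ → sgn s *ℤ (M 0 s *ℤ detℕ n (minor M s)) ≡ + 0
  off-c₀ s s≤n s≢c₀ = begin
    sgn s *ℤ (M 0 s *ℤ detℕ n (minor M s)) ≡⟨ cong (λ x → sgn s *ℤ (x *ℤ detℕ n (minor M s))) (trans (row≡δ s s≤n) (δ-≢ s≢c₀)) ⟩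
    sgn s *ℤ (+ 0 *ℤ detℕ n (minor M s))   ≡⟨ ℤₚ.*-zeroʳ (sgn s) ⟩
    + 0                                    ∎

detℕ-scale-rows : ∀ n (f : ℕ → ℤ) (M : Matrix) → detℕ n (λ r c → f r *ℤ M r c) ≡ ∏ n f *ℤ detℕ n M
detℕ-scale-rows zero    f M = sym (ℤₚ.*-identityˡ (+ 1))
detℕ-scale-rows (suc n) f M = begin
  ∑ (suc n) (λ s → sgn s *ℤ (f 0 *ℤ M 0 s *ℤ detℕ n (λ r c → f (suc r) *ℤ minor M s r c)))
    ≡⟨ ∑-cong (suc n) (λ s _ → begin
         sgn s *ℤ (f 0 *ℤ M 0 s *ℤ detℕ n (λ r c → f (suc r) *ℤ minor M s r c))
           ≡⟨ cong (λ x → sgn s *ℤ (f 0 *ℤ M 0 s *ℤ x)) (detℕ-scale-rows n (f ∘ suc) (minor M s)) ⟩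
         sgn s *ℤ (f 0 *ℤ M 0 s *ℤ (∏ n (f ∘ suc) *ℤ detℕ n (minor M s)))
           ≡⟨ regroup (sgn s) (f 0) (M 0 s) (∏ n (f ∘ suc)) _ ⟩
         f 0 *ℤ ∏ n (f ∘ suc) *ℤ (sgn s *ℤ (M 0 s *ℤ detℕ n (minor M s))) ∎) ⟩
  ∑ (suc n) (λ s → f 0 *ℤ ∏ n (f ∘ suc) *ℤ (sgn s *ℤ (M 0 s *ℤ detℕ n (minor M s))))
    ≡⟨ *-distribˡ-∑ (suc n) (∏ (suc n) f) (laplaceTerm n M) ⟩
  ∏ (suc n) f *ℤ detℕ (suc n) M ∎
  where regroup : ∀ a b c d e → a *ℤ (b *ℤ c *ℤ (d *ℤ e)) ≡ b *ℤ d *ℤ (a *ℤ (c *ℤ e))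
        regroup = solve-∀

detℕ-scale-cols : ∀ n (g : ℕ → ℤ) (M : Matrix) → detℕ n (λ r c → g c *ℤ M r c) ≡ ∏ n g *ℤ detℕ n M
detℕ-scale-cols zero    g M = sym (ℤₚ.*-identityˡ (+ 1))
detℕ-scale-cols (suc n) g M = begin
  ∑ (suc n) (λ s → sgn s *ℤ (g s *ℤ M 0 s *ℤ detℕ n (λ r c → g (punchIn s c) *ℤ minor M s r c)))
    ≡⟨ ∑-cong (suc n) (λ s s≤n → begin
         sgn s *ℤ (g s *ℤ M 0 s *ℤ detℕ n (λ r c → g (punchIn s c) *ℤ minor M s r c))
           ≡⟨ cong (λ x → sgn s *ℤ (g s *ℤ M 0 s *ℤ x)) (detℕ-scale-cols n (g ∘ punchIn s) (minor M s)) ⟩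
         sgn s *ℤ (g s *ℤ M 0 s *ℤ (∏ n (g ∘ punchIn s) *ℤ detℕ n (minor M s)))
           ≡⟨ regroup (sgn s) (g s) (M 0 s) (∏ n (g ∘ punchIn s)) _ ⟩
         g s *ℤ ∏ n (g ∘ punchIn s) *ℤ (sgn s *ℤ (M 0 s *ℤ detℕ n (minor M s)))
           ≡⟨ cong (_*ℤ (sgn s *ℤ (M 0 s *ℤ detℕ n (minor M s)))) (sym (∏-punchIn n s g s≤n)) ⟩
         ∏ (suc n) g *ℤ (sgn s *ℤ (M 0 s *ℤ detℕ n (minor M s))) ∎) ⟩
  ∑ (suc n) (λ s → ∏ (suc n) g *ℤ (sgn s *ℤ (M 0 s *ℤ detℕ n (minor M s))))
    ≡⟨ *-distribˡ-∑ (suc n) (∏ (suc n) g) (laplaceTerm n M) ⟩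
  ∏ (suc n) g *ℤ detℕ (suc n) M ∎
  where regroup : ∀ a b c d e → a *ℤ (b *ℤ c *ℤ (d *ℤ e)) ≡ b *ℤ d *ℤ (a *ℤ (c *ℤ e))
        regroup = solve-∀

detℕ-sign-pattern : ∀ d k (N : Matrix) → detℕ k (λ j c → sgn (d + j) *ℤ (sgn c *ℤ N j c)) ≡ sgn (d * k) *ℤ detℕ k N
detℕ-sign-pattern d k N = begin
  detℕ k (λ j c → sgn (d + j) *ℤ (sgn c *ℤ N j c))           ≡⟨ detℕ-scale-rows k (λ j → sgn (d + j)) (λ j c → sgn c *ℤ N j c) ⟩
  ∏ k (λ j → sgn (d + j)) *ℤ detℕ k (λ j c → sgn c *ℤ N j c) ≡⟨ cong (∏ k (λ j → sgn (d + j)) *ℤ_) (detℕ-scale-cols k sgn N) ⟩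
  ∏ k (λ j → sgn (d + j)) *ℤ (∏ k sgn *ℤ detℕ k N)           ≡⟨ ℤₚ.*-assoc (∏ k (λ j → sgn (d + j))) (∏ k sgn) (detℕ k N) ⟨
  ∏ k (λ j → sgn (d + j)) *ℤ ∏ k sgn *ℤ detℕ k N             ≡⟨ cong (_*ℤ detℕ k N) (∏-sgn d k) ⟩
  sgn (d * k) *ℤ detℕ k N                                    ∎

detℕ-unit-rows-top : ∀ d k (Z : Matrix) → (∀ r c → r < d → c < d + k → Z r c ≡ δ c (k + r)) →
  detℕ (d + k) Z ≡ sgn (d * k) *ℤ detℕ k (λ r c → Z (d + r) c)
detℕ-unit-rows-top zero    k Z _     = sym (ℤₚ.*-identityˡ _)
detℕ-unit-rows-top (suc d) k Z units = begin
  detℕ (suc d + k) Z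
    ≡⟨ detℕ-unit-row (d + k) k Z (s≤s (m≤n+m k d)) (λ c c<n → trans (units 0 c (s≤s z≤n) c<n) (cong (δ c) (+-identityʳ k))) ⟩
  sgn k *ℤ detℕ (d + k) (minor Z k)
    ≡⟨ cong (sgn k *ℤ_) (detℕ-unit-rows-top d k (minor Z k) minor-units) ⟩
  sgn k *ℤ (sgn (d * k) *ℤ detℕ k (λ r c → Z (suc d + r) (punchIn k c)))
    ≡⟨ cong (λ x → sgn k *ℤ (sgn (d * k) *ℤ x)) (detℕ-cong k (λ r c _ c<k → cong (Z (suc d + r)) (punchIn-< k c c<k))) ⟩
  sgn k *ℤ (sgn (d * k) *ℤ detℕ k (λ r c → Z (suc d + r) c))
    ≡⟨ ℤₚ.*-assoc (sgn k) (sgn (d * k)) _ ⟨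
  sgn k *ℤ sgn (d * k) *ℤ detℕ k (λ r c → Z (suc d + r) c)
    ≡⟨ cong (_*ℤ detℕ k (λ r c → Z (suc d + r) c)) (sgn-+ k (d * k)) ⟨
  sgn (suc d * k) *ℤ detℕ k (λ r c → Z (suc d + r) c) ∎
  where
  minor-units : ∀ r c → r < d → c < d + k → minor Z k r c ≡ δ c (k + r)
  minor-units r c r<d c<n = begin
    Z (suc r) (punchIn k c)   ≡⟨ units (suc r) (punchIn k c) (s≤s r<d) (punchIn-bounded k c<n) ⟩
    δ (punchIn k c) (k + suc r) ≡⟨ cong (δ (punchIn k c)) (+-suc k r) ⟩
    δ (punchIn k c) (suc (k + r)) ≡⟨ δ-punchIn k c (k + r) (m≤m+n k r) ⟩
    δ c (k + r)               ∎

detℕ-unit-rows-bottom : ∀ d k (Y : Matrix) → (∀ j c → j < k → c < d + k → Y (d + j) c ≡ δ c (d + j)) →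
  detℕ (d + k) Y ≡ detℕ d Y
detℕ-unit-rows-bottom zero k Y units = begin
  detℕ k Y                        ≡⟨ cong (λ m → detℕ m Y) (+-identityʳ k) ⟨
  detℕ (k + 0) Y                  ≡⟨ detℕ-unit-rows-top k 0 Y (λ r c r<k c<k → units r c r<k (subst (c <_) (+-identityʳ k) c<k)) ⟩
  sgn (k * 0) *ℤ + 1              ≡⟨ cong (λ m → sgn m *ℤ + 1) (*-zeroʳ k) ⟩
  + 1                             ∎
detℕ-unit-rows-bottom (suc d) k Y units = begin
  ∑ (suc d + k) (laplaceTerm (d + k) Y)
    ≡⟨ ∑-split (suc d) k (laplaceTerm (d + k) Y) ⟩
  ∑ (suc d) (laplaceTerm (d + k) Y) +ℤ ∑ k (λ t → laplaceTerm (d + k) Y (suc d + t))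
    ≡⟨ cong₂ _+ℤ_ (∑-cong (suc d) left-part) (∑-zero k right-part) ⟩
  ∑ (suc d) (laplaceTerm d Y) +ℤ + 0
    ≡⟨ ℤₚ.+-identityʳ _ ⟩
  detℕ (suc d) Y ∎
  where
  left-part : ∀ s → s < suc d → laplaceTerm (d + k) Y s ≡ laplaceTerm d Y s
  left-part s (s≤s s≤d) = cong (λ x → sgn s *ℤ (Y 0 s *ℤ x)) (detℕ-unit-rows-bottom d k (minor Y s) λ j c j<k c<n →
    trans (units j (punchIn s c) j<k (punchIn-bounded s c<n)) (δ-punchIn s c (d + j) (≤-trans s≤d (m≤m+n d j))))
  right-part : ∀ t → t < k → laplaceTerm (d + k) Y (suc d + t) ≡ + 0
  right-part t t<k = begin
    sgn (suc d + t) *ℤ (Y 0 (suc d + t) *ℤ detℕ (d + k) (minor Y (suc d + t)))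
      ≡⟨ cong (λ x → sgn (suc d + t) *ℤ (Y 0 (suc d + t) *ℤ x)) minor≡0 ⟩
    sgn (suc d + t) *ℤ (Y 0 (suc d + t) *ℤ + 0)
      ≡⟨ cong (sgn (suc d + t) *ℤ_) (ℤₚ.*-zeroʳ (Y 0 (suc d + t))) ⟩
    sgn (suc d + t) *ℤ + 0
      ≡⟨ ℤₚ.*-zeroʳ (sgn (suc d + t)) ⟩
    + 0 ∎
    where
    minor≡0 = detℕ-zero-row (d + k) (d + t) (minor Y (suc d + t)) (+-monoʳ-< d t<k) λ c c<n →
      trans (units t (punchIn (suc d + t) c) t<k (punchIn-bounded (suc d + t) c<n)) (δ-≢ (punchInₛ≢s (suc d + t) c))

-- Column operations

AgreeOffCol : ℕ → ℕ → Matrix → Matrix → Set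
AgreeOffCol n c A B = ∀ r x → r < n → x < n → x ≢ c → A r x ≡ B r x

minor-agreeOffCol-self : ∀ {n c A B} → AgreeOffCol (suc n) c A B → ∀ r x → r < n → x < n → minor A c r x ≡ minor B c r x
minor-agreeOffCol-self {c = c} A≈B r x r<n x<n = A≈B (suc r) (punchIn c x) (s≤s r<n) (punchIn-bounded c x<n) (punchInₛ≢s c x)

minor-agreeOffCol : ∀ {n s c A B} → s ≢ c → AgreeOffCol (suc n) c A B →
  AgreeOffCol n (punchOut s c) (minor A s) (minor B s)
minor-agreeOffCol {s = s} {c} s≢c A≈B r x r<n x<n x≢c′ =
  A≈B (suc r) (punchIn s x) (s≤s r<n) (punchIn-bounded s x<n) λ eq →
    x≢c′ (punchIn-injective s x (punchOut s c) (trans eq (sym (punchIn-punchOut s≢c))))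

detℕ-linear-col : ∀ n c (A B B′ : Matrix) (l : ℤ) → c < n → AgreeOffCol n c A B → AgreeOffCol n c B′ B →
  (∀ r → r < n → A r c ≡ B r c +ℤ l *ℤ B′ r c) → detℕ n A ≡ detℕ n B +ℤ l *ℤ detℕ n B′
detℕ-linear-col (suc n) c A B B′ l c≤n A≈B B′≈B col-c = begin
  ∑ (suc n) (laplaceTerm n A)                                    ≡⟨ ∑-cong (suc n) term ⟩
  ∑ (suc n) (λ s → laplaceTerm n B s +ℤ l *ℤ laplaceTerm n B′ s) ≡⟨ ∑-distrib-+ (suc n) (laplaceTerm n B) (λ s → l *ℤ laplaceTerm n B′ s) ⟩
  detℕ (suc n) B +ℤ ∑ (suc n) (λ s → l *ℤ laplaceTerm n B′ s)    ≡⟨ cong (detℕ (suc n) B +ℤ_) (*-distribˡ-∑ (suc n) l (laplaceTerm n B′)) ⟩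
  detℕ (suc n) B +ℤ l *ℤ detℕ (suc n) B′                          ∎
  where
  term : ∀ s → s < suc n → laplaceTerm n A s ≡ laplaceTerm n B s +ℤ l *ℤ laplaceTerm n B′ s
  term s s≤n with s ≟ c
  ... | yes refl = begin
    sgn s *ℤ (A 0 s *ℤ detℕ n (minor A s))
      ≡⟨ cong₂ (λ x y → sgn s *ℤ (x *ℤ y)) (col-c 0 (s≤s z≤n)) (detℕ-cong n (minor-agreeOffCol-self A≈B)) ⟩
    sgn s *ℤ ((B 0 s +ℤ l *ℤ B′ 0 s) *ℤ detℕ n (minor B s))
      ≡⟨ expand (sgn s) (B 0 s) l (B′ 0 s) _ ⟩
    sgn s *ℤ (B 0 s *ℤ detℕ n (minor B s)) +ℤ l *ℤ (sgn s *ℤ (B′ 0 s *ℤ detℕ n (minor B s)))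
      ≡⟨ cong (λ x → laplaceTerm n B s +ℤ l *ℤ (sgn s *ℤ (B′ 0 s *ℤ x))) (sym (detℕ-cong n (minor-agreeOffCol-self B′≈B))) ⟩
    laplaceTerm n B s +ℤ l *ℤ laplaceTerm n B′ s ∎
    where expand : ∀ a b l c d → a *ℤ ((b +ℤ l *ℤ c) *ℤ d) ≡ a *ℤ (b *ℤ d) +ℤ l *ℤ (a *ℤ (c *ℤ d))
          expand = solve-∀
  ... | no s≢c = begin
    sgn s *ℤ (A 0 s *ℤ detℕ n (minor A s))
      ≡⟨ cong₂ (λ x y → sgn s *ℤ (x *ℤ y)) (A≈B 0 s (s≤s z≤n) s≤n s≢c) minor-linear ⟩
    sgn s *ℤ (B 0 s *ℤ (detℕ n (minor B s) +ℤ l *ℤ detℕ n (minor B′ s)))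
      ≡⟨ expand (sgn s) (B 0 s) _ l _ ⟩
    laplaceTerm n B s +ℤ l *ℤ (sgn s *ℤ (B 0 s *ℤ detℕ n (minor B′ s)))
      ≡⟨ cong (λ x → laplaceTerm n B s +ℤ l *ℤ (sgn s *ℤ (x *ℤ detℕ n (minor B′ s)))) (sym (B′≈B 0 s (s≤s z≤n) s≤n s≢c)) ⟩
    laplaceTerm n B s +ℤ l *ℤ laplaceTerm n B′ s ∎
    where
    expand : ∀ a b d l e → a *ℤ (b *ℤ (d +ℤ l *ℤ e)) ≡ a *ℤ (b *ℤ d) +ℤ l *ℤ (a *ℤ (b *ℤ e))
    expand = solve-∀
    c′≡c : punchIn s (punchOut s c) ≡ c
    c′≡c = punchIn-punchOut s≢c
    minor-linear = detℕ-linear-col n (punchOut s c) (minor A s) (minor B s) (minor B′ s) l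
      (punchOut-bounded s≤n c≤n s≢c) (minor-agreeOffCol s≢c A≈B) (minor-agreeOffCol s≢c B′≈B)
      (λ r r<n → subst (λ x → A (suc r) x ≡ B (suc r) x +ℤ l *ℤ B′ (suc r) x) (sym c′≡c) (col-c (suc r) (s≤s r<n)))

detℕ-adjSwap-cols : ∀ n c (A B : Matrix) → suc c < n → (∀ r x → r < n → x < n → A r x ≡ B r (adjSwap c x)) →
  detℕ n A ≡ - detℕ n B
detℕ-adjSwap-cols (suc n) c A B c+1≤n A≡Bσ = begin
  ∑ (suc n) (laplaceTerm n A)                       ≡⟨ ∑-cong (suc n) term ⟩
  ∑ (suc n) (λ s → - laplaceTerm n B (adjSwap c s)) ≡⟨ neg-distrib-∑ (suc n) (laplaceTerm n B ∘ adjSwap c) ⟩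
  - ∑ (suc n) (laplaceTerm n B ∘ adjSwap c)         ≡⟨ cong -_ (∑-adjSwap (suc n) c (laplaceTerm n B) c+1≤n) ⟩
  - detℕ (suc n) B                                  ∎
  where
  minor≡ : ∀ s t → (∀ x → adjSwap c (punchIn s x) ≡ punchIn t x) → detℕ n (minor A s) ≡ detℕ n (minor B t)
  minor≡ s t σ∘punchIn = detℕ-cong n λ r x r<n x<n →
    trans (A≡Bσ (suc r) (punchIn s x) (s≤s r<n) (punchIn-bounded s x<n)) (cong (B (suc r)) (σ∘punchIn x))
  row0 : ∀ s → s < suc n → A 0 s ≡ B 0 (adjSwap c s)
  row0 s = A≡Bσ 0 s (s≤s z≤n)
  term : ∀ s → s < suc n → laplaceTerm n A s ≡ - laplaceTerm n B (adjSwap c s)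
  term s s≤n with s ≟ c | s ≟ suc c
  ... | yes refl | _ = begin
    sgn s *ℤ (A 0 s *ℤ detℕ n (minor A s))
      ≡⟨ cong₂ (λ x y → sgn s *ℤ (x *ℤ y)) (trans (row0 s s≤n) (cong (B 0) (adjSwap-self s)))
                                            (minor≡ s (suc s) (adjSwap-punchIn-self s)) ⟩
    sgn s *ℤ (B 0 (suc s) *ℤ detℕ n (minor B (suc s)))   ≡⟨ neg-involutive-* (sgn s) _ ⟩
    - laplaceTerm n B (suc s)                           ≡⟨ cong (-_ ∘ laplaceTerm n B) (sym (adjSwap-self s)) ⟩
    - laplaceTerm n B (adjSwap s s)                     ∎
    where neg-involutive-* : ∀ a b → a *ℤ b ≡ - ((- a) *ℤ b)
          neg-involutive-* = solve-∀
  ... | no _ | yes refl = begin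
    sgn (suc c) *ℤ (A 0 (suc c) *ℤ detℕ n (minor A (suc c)))
      ≡⟨ cong₂ (λ x y → sgn (suc c) *ℤ (x *ℤ y)) (trans (row0 (suc c) s≤n) (cong (B 0) (adjSwap-suc c)))
                                                  (minor≡ (suc c) c (adjSwap-punchIn-suc c)) ⟩
    (- sgn c) *ℤ (B 0 c *ℤ detℕ n (minor B c))   ≡⟨ ℤₚ.neg-distribˡ-* (sgn c) _ ⟨
    - laplaceTerm n B c                         ≡⟨ cong (-_ ∘ laplaceTerm n B) (sym (adjSwap-suc c)) ⟩
    - laplaceTerm n B (adjSwap c (suc c))       ∎
  ... | no s≢c | no s≢c+1 = begin
    sgn s *ℤ (A 0 s *ℤ detℕ n (minor A s))
      ≡⟨ cong₂ (λ x y → sgn s *ℤ (x *ℤ y)) (trans (row0 s s≤n) (cong (B 0) σs≡s)) minor-swapped ⟩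
    sgn s *ℤ (B 0 s *ℤ (- detℕ n (minor B s)))   ≡⟨ neg-inside (sgn s) (B 0 s) _ ⟩
    - laplaceTerm n B s                         ≡⟨ cong (-_ ∘ laplaceTerm n B) (sym σs≡s) ⟩
    - laplaceTerm n B (adjSwap c s)             ∎
    where
    σs≡s = adjSwap-other c s s≢c s≢c+1
    neg-inside : ∀ a b d → a *ℤ (b *ℤ (- d)) ≡ - (a *ℤ (b *ℤ d))
    neg-inside = solve-∀
    minor-swapped = detℕ-adjSwap-cols n (punchOut s c) (minor A s) (minor B s)
      (punchOut-adjacent-bounded s≤n c+1≤n s≢c s≢c+1) λ r x r<n x<n →
        trans (A≡Bσ (suc r) (punchIn s x) (s≤s r<n) (punchIn-bounded s x<n)) (cong (B (suc r)) (adjSwap-punchIn s c x s≢c s≢c+1))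

≡-neg⇒≡0 : ∀ {x : ℤ} → x ≡ - x → x ≡ + 0
≡-neg⇒≡0 {+ zero}   _  = refl
≡-neg⇒≡0 {+ suc n}  ()
≡-neg⇒≡0 { -[1+ n ]} ()

detℕ-equal-cols : ∀ n c c′ (A : Matrix) → c < c′ → c′ < n → (∀ r → r < n → A r c ≡ A r c′) → detℕ n A ≡ + 0
detℕ-equal-cols n c (suc c′) A (s≤s c≤c′) c′<n col≡ with c ≟ c′
... | yes refl = ≡-neg⇒≡0 (detℕ-adjSwap-cols n c A A c′<n swap-invariant)
  where
  swap-invariant : ∀ r x → r < n → x < n → A r x ≡ A r (adjSwap c x)
  swap-invariant r x r<n _ with x ≟ c | x ≟ suc c
  ... | yes refl | _        = trans (col≡ r r<n) (cong (A r) (sym (adjSwap-self c)))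
  ... | no _     | yes refl = trans (sym (col≡ r r<n)) (cong (A r) (sym (adjSwap-suc c)))
  ... | no x≢c   | no x≢c+1 = cong (A r) (sym (adjSwap-other c x x≢c x≢c+1))
... | no c≢c′ = begin
  detℕ n A                       ≡⟨ detℕ-adjSwap-cols n c′ A (A′) c′<n (λ r x _ _ → cong (A r) (sym (adjSwap-involutive c′ x))) ⟩
  - detℕ n A′                    ≡⟨ cong -_ (detℕ-equal-cols n c c′ A′ c<c′ (<-trans (n<1+n c′) c′<n) col≡′) ⟩
  + 0                            ∎
  where
  c<c′ = ≤∧≢⇒< c≤c′ c≢c′
  A′ : Matrix
  A′ r x = A r (adjSwap c′ x)
  col≡′ : ∀ r → r < n → A′ r c ≡ A′ r c′
  col≡′ r r<n = begin
    A r (adjSwap c′ c) ≡⟨ cong (A r) (adjSwap-other c′ c c≢c′ (<⇒≢ (<-trans c<c′ (n<1+n c′)))) ⟩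
    A r c              ≡⟨ col≡ r r<n ⟩
    A r (suc c′)       ≡⟨ cong (A r) (sym (adjSwap-self c′)) ⟩
    A r (adjSwap c′ c′) ∎

replaceCol : ℕ → (ℕ → ℤ) → Matrix → Matrix
replaceCol j v M r x with x ≟ j
... | yes _ = v r
... | no  _ = M r x

replaceCol-at : ∀ j v M r → replaceCol j v M r j ≡ v r
replaceCol-at j v M r with j ≟ j
... | yes _   = refl
... | no  j≢j = ⊥-elim (j≢j refl)

replaceCol-off : ∀ j v M r x → x ≢ j → replaceCol j v M r x ≡ M r x
replaceCol-off j v M r x x≢j with x ≟ j
... | yes x≡j = ⊥-elim (x≢j x≡j)
... | no  _   = refl

replaceCol-≗ : ∀ {j v M} (N : Matrix) r x → (x ≡ j → v r ≡ N r x) → (x ≢ j → M r x ≡ N r x) → replaceCol j v M r x ≡ N r x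
replaceCol-≗ {j} N r x at off with x ≟ j
... | yes x≡j = at x≡j
... | no  x≢j = off x≢j

detℕ-add-col-multiple : ∀ n i j (A B : Matrix) (l : ℤ) → i < n → j < n → i ≢ j → AgreeOffCol n j A B →
  (∀ r → r < n → A r j ≡ B r j +ℤ l *ℤ B r i) → detℕ n A ≡ detℕ n B
detℕ-add-col-multiple n i j A B l i<n j<n i≢j A≈B col-j = begin
  detℕ n A                   ≡⟨ detℕ-linear-col n j A B B′ l j<n A≈B (λ r x _ _ x≢j → replaceCol-off j _ B r x x≢j) col-j′ ⟩
  detℕ n B +ℤ l *ℤ detℕ n B′ ≡⟨ cong (λ x → detℕ n B +ℤ l *ℤ x) detB′≡0 ⟩
  detℕ n B +ℤ l *ℤ + 0       ≡⟨ cong (detℕ n B +ℤ_) (ℤₚ.*-zeroʳ l) ⟩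
  detℕ n B +ℤ + 0            ≡⟨ ℤₚ.+-identityʳ _ ⟩
  detℕ n B                   ∎
  where
  B′ : Matrix
  B′ = replaceCol j (λ r → B r i) B
  col-j′ : ∀ r → r < n → A r j ≡ B r j +ℤ l *ℤ B′ r j
  col-j′ r r<n = trans (col-j r r<n) (cong (λ x → B r j +ℤ l *ℤ x) (sym (replaceCol-at j _ B r)))
  B′-cols : ∀ r → r < n → B′ r i ≡ B′ r j
  B′-cols r _ = trans (replaceCol-off j _ B r i i≢j) (sym (replaceCol-at j _ B r))
  detB′≡0 : detℕ n B′ ≡ + 0
  detB′≡0 with <-cmp i j
  ... | tri< i<j _ _ = detℕ-equal-cols n i j B′ i<j j<n B′-cols
  ... | tri≈ _ i≡j _ = ⊥-elim (i≢j i≡j)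
  ... | tri> _ _ j<i = detℕ-equal-cols n j i B′ j<i i<n (λ r r<n → sym (B′-cols r r<n))

detℕ-add-col-combination : ∀ n j (A B : Matrix) (μ : ℕ → ℤ) → j < n → μ j ≡ + 0 → AgreeOffCol n j A B →
  (∀ r → r < n → A r j ≡ B r j +ℤ ∑ n (λ i → μ i *ℤ B r i)) → detℕ n A ≡ detℕ n B
detℕ-add-col-combination n j A B μ j<n μj≡0 A≈B col-j = trans (detℕ-cong n A≡Aₙ) (partial n ≤-refl)
  where
  column : ℕ → ℕ → ℤ
  column m r = B r j +ℤ ∑ m (λ i → μ i *ℤ B r i)
  column-suc : ∀ m r → column (suc m) r ≡ column m r +ℤ μ m *ℤ B r m
  column-suc m r = trans (cong (B r j +ℤ_) (∑-last m (λ i → μ i *ℤ B r i))) (sym (ℤₚ.+-assoc (B r j) _ _))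
  Aₘ : ℕ → Matrix
  Aₘ m = replaceCol j (column m) B
  Aₘ-off : ∀ m m′ r x → x ≢ j → Aₘ m r x ≡ Aₘ m′ r x
  Aₘ-off m m′ r x x≢j = trans (replaceCol-off j _ B r x x≢j) (sym (replaceCol-off j _ B r x x≢j))
  A≡Aₙ : ∀ r x → r < n → x < n → A r x ≡ Aₘ n r x
  A≡Aₙ r x r<n x<n = sym (replaceCol-≗ A r x (λ { refl → sym (col-j r r<n) }) (λ x≢j → sym (A≈B r x r<n x<n x≢j)))
  A₀≡B : ∀ r x → Aₘ 0 r x ≡ B r x
  A₀≡B r x = replaceCol-≗ B r x (λ { refl → ℤₚ.+-identityʳ (B r x) }) (λ _ → refl)
  step : ∀ m → m < n → detℕ n (Aₘ (suc m)) ≡ detℕ n (Aₘ m)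
  step m m<n with m ≟ j
  ... | yes refl = detℕ-cong n λ r x _ _ → same-columns r x
    where
    same-columns : ∀ r x → Aₘ (suc m) r x ≡ Aₘ m r x
    same-columns r x = replaceCol-≗ (Aₘ m) r x (λ { refl → at-m }) (λ x≢m → sym (replaceCol-off m _ B r x x≢m))
      where
      at-m : column (suc m) r ≡ Aₘ m r m
      at-m = begin
        column (suc m) r           ≡⟨ column-suc m r ⟩
        column m r +ℤ μ m *ℤ B r m ≡⟨ cong (λ y → column m r +ℤ y *ℤ B r m) μj≡0 ⟩
        column m r +ℤ + 0          ≡⟨ ℤₚ.+-identityʳ _ ⟩
        column m r                 ≡⟨ replaceCol-at m _ B r ⟨
        Aₘ m r m                   ∎
  ... | no m≢j = detℕ-add-col-multiple n m j (Aₘ (suc m)) (Aₘ m) (μ m) m<n j<n m≢j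
    (λ r x _ _ x≢j → Aₘ-off (suc m) m r x x≢j)
    (λ r _ → begin
      Aₘ (suc m) r j                      ≡⟨ replaceCol-at j _ B r ⟩
      column (suc m) r                    ≡⟨ column-suc m r ⟩
      column m r +ℤ μ m *ℤ B r m          ≡⟨ cong₂ (λ x y → x +ℤ μ m *ℤ y) (replaceCol-at j _ B r) (replaceCol-off j _ B r m m≢j) ⟨
      Aₘ m r j +ℤ μ m *ℤ Aₘ m r m         ∎)
  partial : ∀ m → m ≤ n → detℕ n (Aₘ m) ≡ detℕ n B
  partial zero    _   = detℕ-cong n λ r x _ _ → A₀≡B r x
  partial (suc m) m<n = trans (step m m<n) (partial m (<⇒≤ m<n))

_·⟨_⟩_ : Matrix → ℕ → Matrix → Matrix
(Y ·⟨ n ⟩ L) r c = ∑ n (λ i → Y r i *ℤ L i c)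

if_<_then_else_ : ℕ → ℕ → ℤ → ℤ → ℤ
if x < t then a else b with x <? t
... | yes _ = a
... | no  _ = b

if-<-yes : ∀ {x t} {a b : ℤ} → x < t → (if x < t then a else b) ≡ a
if-<-yes {x} {t} x<t with x <? t
... | yes _   = refl
... | no  x≮t = ⊥-elim (x≮t x<t)

if-<-no : ∀ {x t} {a b : ℤ} → t ≤ x → (if x < t then a else b) ≡ b
if-<-no {x} {t} t≤x with x <? t
... | yes x<t = ⊥-elim (<⇒≱ x<t t≤x)
... | no  _   = refl

detℕ-*-unitriangular : ∀ n (Y L : Matrix) → (∀ i → i < n → L i i ≡ + 1) → (∀ i c → i < c → c < n → L i c ≡ + 0) →
  detℕ n (Y ·⟨ n ⟩ L) ≡ detℕ n Y
detℕ-*-unitriangular n Y L diag upper = trans (detℕ-cong n YL≡Yₙ) (partial n ≤-refl)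
  where
  YL = Y ·⟨ n ⟩ L
  Yₜ : ℕ → Matrix
  Yₜ t r x = if x < t then YL r x else Y r x
  YL≡Yₙ : ∀ r x → r < n → x < n → YL r x ≡ Yₜ n r x
  YL≡Yₙ r x _ x<n = sym (if-<-yes x<n)
  step : ∀ t → t < n → detℕ n (Yₜ (suc t)) ≡ detℕ n (Yₜ t)
  step t t<n = detℕ-add-col-combination n t (Yₜ (suc t)) (Yₜ t) μ t<n μt≡0 agree column-t
    where
    -- As L is unitriangular, μ vanishes for i ≤ t, while Yₜ t agrees with Y in the columns ≥ t;
    -- so column t of Y·L is column t of Yₜ t plus the μ-combination of its other columns.
    μ : ℕ → ℤ
    μ i = L i t - δ i t
    μt≡0 : μ t ≡ + 0
    μt≡0 = cong₂ _-_ (diag t t<n) (δ-refl t)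
    agree : AgreeOffCol n t (Yₜ (suc t)) (Yₜ t)
    agree r x _ _ x≢t with <-cmp x t
    ... | tri< x<t _ _ = trans (if-<-yes (m<n⇒m<1+n x<t)) (sym (if-<-yes x<t))
    ... | tri≈ _ x≡t _ = ⊥-elim (x≢t x≡t)
    ... | tri> _ _ t<x = trans (if-<-no t<x) (sym (if-<-no (<⇒≤ t<x)))
    μY : ∀ r i → μ i *ℤ Yₜ t r i ≡ μ i *ℤ Y r i
    μY r i with <-≤-connex i t
    ... | inj₁ i<t = begin
      μ i *ℤ Yₜ t r i ≡⟨ cong (_*ℤ Yₜ t r i) μi≡0 ⟩
      + 0             ≡⟨ cong (_*ℤ Y r i) μi≡0 ⟨
      μ i *ℤ Y r i    ∎
      where μi≡0 = cong₂ _-_ (upper i t i<t t<n) (δ-≢ (<⇒≢ i<t))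
    ... | inj₂ t≤i = cong (μ i *ℤ_) (if-<-no t≤i)
    column-t : ∀ r → r < n → Yₜ (suc t) r t ≡ Yₜ t r t +ℤ ∑ n (λ i → μ i *ℤ Yₜ t r i)
    column-t r _ = begin
      Yₜ (suc t) r t                                 ≡⟨ if-<-yes (n<1+n t) ⟩
      YL r t                                         ≡⟨ ∑-cong n (λ i _ → ℤₚ.*-comm (Y r i) (L i t)) ⟩
      ∑ n (λ i → L i t *ℤ Y r i)                     ≡⟨ shift (∑ n (λ i → L i t *ℤ Y r i)) (Y r t) ⟩
      Y r t +ℤ (∑ n (λ i → L i t *ℤ Y r i) - Y r t)  ≡⟨ cong (Y r t +ℤ_) (∑-sub-δ n t (λ i → L i t) (Y r) t<n) ⟨
      Y r t +ℤ ∑ n (λ i → μ i *ℤ Y r i)              ≡⟨ cong₂ _+ℤ_ (if-<-no (≤-refl {t})) (∑-cong n (λ i _ → μY r i)) ⟨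
      Yₜ t r t +ℤ ∑ n (λ i → μ i *ℤ Yₜ t r i)        ∎
      where shift : ∀ s y → s ≡ y +ℤ (s - y)
            shift = solve-∀
  partial : ∀ t → t ≤ n → detℕ n (Yₜ t) ≡ detℕ n Y
  partial zero    _   = detℕ-cong n λ r x _ _ → if-<-no {x} {0} {YL r x} z≤n
  partial (suc t) t<n = trans (step t t<n) (partial t (<⇒≤ t<n))

-- Binomial identities

C-factorials : ∀ a b → ((a + b) C a) * (a ! * b !) ≡ (a + b) !
C-factorials a b = begin
  ((a + b) C a) * (a ! * b !)              ≡⟨ cong (λ x → ((a + b) C a) * (a ! * x !)) (m+n∸m≡n a b) ⟨
  ((a + b) C a) * (a ! * (a + b ∸ a) !)    ≡⟨ cong (_* (a ! * (a + b ∸ a) !)) (nCk≡n!/k![n-k]! a≤a+b) ⟩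
  ((a + b) ! / (a ! * (a + b ∸ a) !)) * (a ! * (a + b ∸ a) !)
                                         ≡⟨ m/n*n≡m (k![n∸k]!∣n! a≤a+b) ⟩
  (a + b) !                              ∎
  where
  a≤a+b = m≤m+n a b
  instance
    _ : NonZero (a ! * (a + b ∸ a) !)
    _ = a !* (a + b ∸ a) !≢0

C-revision-+ : ∀ m u v → ((m + u + v) C (m + u)) * ((m + u) C m) ≡ ((m + u + v) C m) * ((u + v) C u)
C-revision-+ m u v = *-cancelʳ-≡ _ _ (m ! * u ! * v !) {{m*n≢0 _ _ {{m !* u !≢0}} {{v !≢0}}}} (trans lhs (sym rhs))
  where
  lhs : ((m + u + v) C (m + u)) * ((m + u) C m) * (m ! * u ! * v !) ≡ (m + u + v) !
  lhs = begin
    ((m + u + v) C (m + u)) * ((m + u) C m) * (m ! * u ! * v !)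
      ≡⟨ regroup ((m + u + v) C (m + u)) ((m + u) C m) (m !) (u !) (v !) ⟩
    ((m + u + v) C (m + u)) * (((m + u) C m) * (m ! * u !) * v !)
      ≡⟨ cong (λ x → ((m + u + v) C (m + u)) * (x * v !)) (C-factorials m u) ⟩
    ((m + u + v) C (m + u)) * ((m + u) ! * v !)
      ≡⟨ C-factorials (m + u) v ⟩
    (m + u + v) ! ∎
    where regroup : ∀ x y a b c → x * y * (a * b * c) ≡ x * (y * (a * b) * c)
          regroup = ℕ-solve-∀
  rhs : ((m + u + v) C m) * ((u + v) C u) * (m ! * u ! * v !) ≡ (m + u + v) !
  rhs = begin
    ((m + u + v) C m) * ((u + v) C u) * (m ! * u ! * v !)
      ≡⟨ regroup ((m + u + v) C m) ((u + v) C u) (m !) (u !) (v !) ⟩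
    ((m + u + v) C m) * (m ! * (((u + v) C u) * (u ! * v !)))
      ≡⟨ cong (λ x → ((m + u + v) C m) * (m ! * x)) (C-factorials u v) ⟩
    ((m + u + v) C m) * (m ! * (u + v) !)
      ≡⟨ cong (λ p → (p C m) * (m ! * (u + v) !)) (+-assoc m u v) ⟩
    ((m + (u + v)) C m) * (m ! * (u + v) !)
      ≡⟨ C-factorials m (u + v) ⟩
    (m + (u + v)) !
      ≡⟨ cong _! (+-assoc m u v) ⟨
    (m + u + v) ! ∎
    where regroup : ∀ z w a b c → z * w * (a * b * c) ≡ z * (a * (w * (b * c)))
          regroup = ℕ-solve-∀

C-revision : ∀ p q m → m ≤ q → (p C q) * (q C m) ≡ (p C m) * ((p ∸ m) C (q ∸ m))
C-revision p q m m≤q with q ≤? p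
... | yes q≤p
  with u , refl ← m≤n⇒∃[o]m+o≡n m≤q
  with v , refl ← m≤n⇒∃[o]m+o≡n q≤p = begin
  ((m + u + v) C (m + u)) * ((m + u) C m)             ≡⟨ C-revision-+ m u v ⟩
  ((m + u + v) C m) * ((u + v) C u)                   ≡⟨ cong₂ (λ x y → ((m + u + v) C m) * (x C y)) p∸m (m+n∸m≡n m u) ⟨
  ((m + u + v) C m) * ((m + u + v ∸ m) C (m + u ∸ m)) ∎
  where p∸m : m + u + v ∸ m ≡ u + v
        p∸m = trans (cong (_∸ m) (+-assoc m u v)) (m+n∸m≡n m (u + v))
... | no q≰p with m ≤? p
...   | yes m≤p = begin
  (p C q) * (q C m)             ≡⟨ cong (_* (q C m)) (k>n⇒nCk≡0 p<q) ⟩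
  0                             ≡⟨ *-zeroʳ (p C m) ⟨
  (p C m) * 0                   ≡⟨ cong ((p C m) *_) (k>n⇒nCk≡0 (∸-monoˡ-< p<q m≤p)) ⟨
  (p C m) * ((p ∸ m) C (q ∸ m)) ∎
  where p<q = ≰⇒> q≰p
...   | no m≰p = begin
  (p C q) * (q C m)             ≡⟨ cong (_* (q C m)) (k>n⇒nCk≡0 (≰⇒> q≰p)) ⟩
  0                             ≡⟨ cong (_* ((p ∸ m) C (q ∸ m))) (k>n⇒nCk≡0 (≰⇒> m≰p)) ⟨
  (p C m) * ((p ∸ m) C (q ∸ m)) ∎

∑-alternating-C : ∀ N L → N < L → ∑ L (λ t → sgn t *ℤ + (N C t)) ≡ δ N 0
∑-alternating-C zero (suc L) _ = begin
  + 1 +ℤ ∑ L (λ t → sgn (suc t) *ℤ + (0 C suc t)) ≡⟨ cong (+ 1 +ℤ_) (∑-zero L (λ t _ → ℤₚ.*-zeroʳ (sgn (suc t)))) ⟩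
  + 1 +ℤ + 0                                      ≡⟨⟩
  + 1                                             ∎
∑-alternating-C (suc N) (suc L) (s≤s N<L) = begin
  + 1 +ℤ ∑ L (λ t → sgn (suc t) *ℤ + (suc N C suc t))   ≡⟨ cong (+ 1 +ℤ_) (∑-cong L (λ t _ → pascal-rule t)) ⟩
  + 1 +ℤ ∑ L (λ t → - f t +ℤ f (suc t))                ≡⟨ cong (+ 1 +ℤ_) (∑-distrib-+ L (λ t → - f t) (f ∘ suc)) ⟩
  + 1 +ℤ (∑ L (λ t → - f t) +ℤ ∑ L (f ∘ suc))          ≡⟨ cong (λ x → + 1 +ℤ (x +ℤ ∑ L (f ∘ suc))) (neg-distrib-∑ L f) ⟩
  + 1 +ℤ (- ∑ L f +ℤ ∑ L (f ∘ suc))                    ≡⟨ cong (λ x → + 1 +ℤ (- x +ℤ ∑ L (f ∘ suc))) sums-agree ⟩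
  + 1 +ℤ (- ∑ (suc L) f +ℤ ∑ L (f ∘ suc))              ≡⟨ telescope (∑ L (f ∘ suc)) ⟩
  + 0                                                 ∎
  where
  f : ℕ → ℤ
  f t = sgn t *ℤ + (N C t)
  pascal-rule : ∀ t → sgn (suc t) *ℤ + (suc N C suc t) ≡ - f t +ℤ f (suc t)
  pascal-rule t = begin
    (- sgn t) *ℤ + (suc N C suc t)             ≡⟨ cong (λ x → (- sgn t) *ℤ + x) (nCk+nC[k+1]≡[n+1]C[k+1] N t) ⟨
    (- sgn t) *ℤ + (N C t + N C suc t)         ≡⟨ cong ((- sgn t) *ℤ_) (ℤₚ.pos-+ (N C t) (N C suc t)) ⟩
    (- sgn t) *ℤ (+ (N C t) +ℤ + (N C suc t))  ≡⟨ distrib (sgn t) _ _ ⟩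
    - f t +ℤ f (suc t)                         ∎
    where distrib : ∀ s a b → (- s) *ℤ (a +ℤ b) ≡ - (s *ℤ a) +ℤ (- s) *ℤ b
          distrib = solve-∀
  sums-agree : ∑ L f ≡ ∑ (suc L) f
  sums-agree = trans (∑-alternating-C N L N<L) (sym (∑-alternating-C N (suc L) (m<n⇒m<1+n N<L)))
  telescope : ∀ s → + 1 +ℤ (- (+ 1 +ℤ s) +ℤ s) ≡ + 0
  telescope = solve-∀

-- The Pascal matrix and its inverse

pascal : ℕ → Matrix
pascal z i c = + ((z + i) C (z + c))

pascal⁻¹ : ℕ → Matrix
pascal⁻¹ z i c = sgn (i + c) *ℤ pascal z i c

pascal-upper : ∀ z {i c} → i < c → pascal z i c ≡ + 0
pascal-upper z i<c = cong +_ (k>n⇒nCk≡0 (+-monoʳ-< z i<c))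

pascal-diagonal : ∀ z i → pascal z i i ≡ + 1
pascal-diagonal z i = cong +_ (nCn≡1 (z + i))

pascal⁻¹-upper : ∀ z {i c} → i < c → pascal⁻¹ z i c ≡ + 0
pascal⁻¹-upper z {i} {c} i<c = trans (cong (sgn (i + c) *ℤ_) (pascal-upper z i<c)) (ℤₚ.*-zeroʳ (sgn (i + c)))

pascal⁻¹-diagonal : ∀ z i → pascal⁻¹ z i i ≡ + 1
pascal⁻¹-diagonal z i = cong₂ _*ℤ_ (sgn-double i) (pascal-diagonal z i)

sgn-double-shift : ∀ c t → sgn (c + t + c) ≡ sgn t
sgn-double-shift c t = begin
  sgn (c + t + c)        ≡⟨ cong sgn (trans (cong (_+ c) (+-comm c t)) (+-assoc t c c)) ⟩
  sgn (t + (c + c))      ≡⟨ sgn-+ t (c + c) ⟩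
  sgn t *ℤ sgn (c + c)   ≡⟨ cong (sgn t *ℤ_) (sgn-double c) ⟩
  sgn t *ℤ + 1           ≡⟨ ℤₚ.*-identityʳ (sgn t) ⟩
  sgn t                  ∎

pascal-pascal⁻¹-term : ∀ z x c t →
  pascal z x (c + t) *ℤ pascal⁻¹ z (c + t) c ≡ pascal z x c *ℤ (sgn t *ℤ + ((x ∸ c) C t))
pascal-pascal⁻¹-term z x c t = begin
  pascal z x (c + t) *ℤ (sgn (c + t + c) *ℤ pascal z (c + t) c)
    ≡⟨ cong (λ s → pascal z x (c + t) *ℤ (s *ℤ pascal z (c + t) c)) (sgn-double-shift c t) ⟩
  pascal z x (c + t) *ℤ (sgn t *ℤ pascal z (c + t) c)
    ≡⟨ exchange (pascal z x (c + t)) (sgn t) (pascal z (c + t) c) ⟩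
  sgn t *ℤ (+ P *ℤ + Q)
    ≡⟨ cong (sgn t *ℤ_) (ℤₚ.pos-* P Q) ⟨
  sgn t *ℤ + (P * Q)
    ≡⟨ cong (λ y → sgn t *ℤ + y) revision ⟩
  sgn t *ℤ + (R * ((x ∸ c) C t))
    ≡⟨ cong (sgn t *ℤ_) (ℤₚ.pos-* R ((x ∸ c) C t)) ⟩
  sgn t *ℤ (pascal z x c *ℤ + ((x ∸ c) C t))
    ≡⟨ exchange (sgn t) (pascal z x c) _ ⟩
  pascal z x c *ℤ (sgn t *ℤ + ((x ∸ c) C t)) ∎
  where
  P = (z + x) C (z + (c + t))
  Q = (z + (c + t)) C (z + c)
  R = (z + x) C (z + c)
  exchange : ∀ u v w → u *ℤ (v *ℤ w) ≡ v *ℤ (u *ℤ w)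
  exchange = solve-∀
  revision : P * Q ≡ R * ((x ∸ c) C t)
  revision = begin
    P * Q                                                 ≡⟨ C-revision (z + x) (z + (c + t)) (z + c) (+-monoʳ-≤ z (m≤m+n c t)) ⟩
    R * ((z + x ∸ (z + c)) C (z + (c + t) ∸ (z + c)))     ≡⟨ cong₂ (λ p q → R * (p C q)) ([m+n]∸[m+o]≡n∸o z x c) (trans ([m+n]∸[m+o]≡n∸o z (c + t) c) (m+n∸m≡n c t)) ⟩
    R * ((x ∸ c) C t)                                     ∎

pascal-inverse : ∀ z n x c → x < n → (pascal z ·⟨ n ⟩ pascal⁻¹ z) x c ≡ δ c x
pascal-inverse z n x c x<n with c ≤? x
... | no c≰x = trans (∑-zero n vanish) (sym (δ-≢ (c≰x ∘ ≤-reflexive)))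
  where
  vanish : ∀ i → i < n → pascal z x i *ℤ pascal⁻¹ z i c ≡ + 0
  vanish i _ with i ≤? x
  ... | yes i≤x = trans (cong (pascal z x i *ℤ_) (pascal⁻¹-upper z (≤-<-trans i≤x (≰⇒> c≰x)))) (ℤₚ.*-zeroʳ (pascal z x i))
  ... | no  i≰x = cong (_*ℤ pascal⁻¹ z i c) (pascal-upper z (≰⇒> i≰x))
... | yes c≤x = begin
  ∑ n F                                                ≡⟨ cong (λ m → ∑ m F) (m+[n∸m]≡n c≤n) ⟨
  ∑ (c + (n ∸ c)) F                                    ≡⟨ ∑-split c (n ∸ c) F ⟩
  ∑ c F +ℤ ∑ (n ∸ c) (λ t → F (c + t))                 ≡⟨ cong₂ _+ℤ_ (∑-zero c below-c) (∑-cong (n ∸ c) (λ t _ → pascal-pascal⁻¹-term z x c t)) ⟩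
  + 0 +ℤ ∑ (n ∸ c) (λ t → R *ℤ alternating t)          ≡⟨ ℤₚ.+-identityˡ _ ⟩
  ∑ (n ∸ c) (λ t → R *ℤ alternating t)                 ≡⟨ *-distribˡ-∑ (n ∸ c) R alternating ⟩
  R *ℤ ∑ (n ∸ c) alternating                           ≡⟨ cong (R *ℤ_) (∑-alternating-C (x ∸ c) (n ∸ c) (∸-monoˡ-< x<n c≤x)) ⟩
  R *ℤ δ (x ∸ c) 0                                     ≡⟨ diagonal-or-zero ⟩
  δ c x                                                ∎
  where
  c≤n = ≤-trans c≤x (<⇒≤ x<n)
  F : ℕ → ℤ
  F i = pascal z x i *ℤ pascal⁻¹ z i c
  R = pascal z x c
  alternating : ℕ → ℤ
  alternating t = sgn t *ℤ + ((x ∸ c) C t)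
  below-c : ∀ i → i < c → F i ≡ + 0
  below-c i i<c = trans (cong (pascal z x i *ℤ_) (pascal⁻¹-upper z i<c)) (ℤₚ.*-zeroʳ (pascal z x i))
  diagonal-or-zero : R *ℤ δ (x ∸ c) 0 ≡ δ c x
  diagonal-or-zero with c ≟ x
  ... | yes refl = begin
    pascal z c c *ℤ δ (c ∸ c) 0 ≡⟨ cong₂ _*ℤ_ (pascal-diagonal z c) (cong (λ m → δ m 0) (n∸n≡0 c)) ⟩
    + 1                         ≡⟨ δ-refl c ⟨
    δ c c                       ∎
  ... | no c≢x = begin
    R *ℤ δ (x ∸ c) 0 ≡⟨ cong (R *ℤ_) (δ-≢ (c≢x ∘ ≤-antisym c≤x ∘ m∸n≡0⇒m≤n)) ⟩
    R *ℤ + 0         ≡⟨ ℤₚ.*-zeroʳ R ⟩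
    + 0              ≡⟨ δ-≢ c≢x ⟨
    δ c x            ∎

pascal-minor-duality : ∀ z k d → detℕ d (λ r → pascal z (k + r)) ≡ detℕ k (λ r → pascal z (d + r))
pascal-minor-duality z k d = begin
  detℕ d M                                                         ≡⟨ detY ⟨
  detℕ n Y                                                         ≡⟨ detℕ-*-unitriangular n Y (pascal⁻¹ z) (λ i _ → pascal⁻¹-diagonal z i) (λ i c i<c _ → pascal⁻¹-upper z i<c) ⟨
  detℕ n (Y ·⟨ n ⟩ pascal⁻¹ z)                                     ≡⟨ detℕ-unit-rows-top d k (Y ·⟨ n ⟩ pascal⁻¹ z) top-rows ⟩
  sgn (d * k) *ℤ detℕ k (λ j c → (Y ·⟨ n ⟩ pascal⁻¹ z) (d + j) c)  ≡⟨ cong (sgn (d * k) *ℤ_) (detℕ-cong k (λ j c j<k _ → bottom-rows j c j<k)) ⟩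
  sgn (d * k) *ℤ detℕ k (λ j c → sgn (d + j) *ℤ (sgn c *ℤ N j c))  ≡⟨ cong (sgn (d * k) *ℤ_) (detℕ-sign-pattern d k N) ⟩
  sgn (d * k) *ℤ (sgn (d * k) *ℤ detℕ k N)                         ≡⟨ ℤₚ.*-assoc (sgn (d * k)) (sgn (d * k)) (detℕ k N) ⟨
  sgn (d * k) *ℤ sgn (d * k) *ℤ detℕ k N                           ≡⟨ cong (_*ℤ detℕ k N) (sgn-square (d * k)) ⟩
  + 1 *ℤ detℕ k N                                                  ≡⟨ ℤₚ.*-identityˡ (detℕ k N) ⟩
  detℕ k N                                                         ∎
  where
  n = d + k
  M N : Matrix
  M r = pascal z (k + r)
  N r = pascal z (d + r)
  -- Multiplying by the unitriangular
  -- inverse Pascal matrix keeps det Y, turns the rows of M into the unit rows e_(k+r), and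
  -- leaves the last k rows of the inverse at the bottom.
  Y : Matrix
  Y r c = if r < d then M r c else δ c r
  detY : detℕ n Y ≡ detℕ d M
  detY = begin
    detℕ n Y ≡⟨ detℕ-unit-rows-bottom d k Y (λ j c _ _ → if-<-no (m≤m+n d j)) ⟩
    detℕ d Y ≡⟨ detℕ-cong d (λ r c r<d _ → if-<-yes r<d) ⟩
    detℕ d M ∎
  top-rows : ∀ r c → r < d → c < n → (Y ·⟨ n ⟩ pascal⁻¹ z) r c ≡ δ c (k + r)
  top-rows r c r<d _ = begin
    ∑ n (λ i → Y r i *ℤ pascal⁻¹ z i c)    ≡⟨ ∑-cong n (λ i _ → cong (_*ℤ pascal⁻¹ z i c) (if-<-yes r<d)) ⟩
    (pascal z ·⟨ n ⟩ pascal⁻¹ z) (k + r) c ≡⟨ pascal-inverse z n (k + r) c (subst (k + r <_) (+-comm k d) (+-monoʳ-< k r<d)) ⟩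
    δ c (k + r)                            ∎
  bottom-rows : ∀ j c → j < k → (Y ·⟨ n ⟩ pascal⁻¹ z) (d + j) c ≡ sgn (d + j) *ℤ (sgn c *ℤ N j c)
  bottom-rows j c j<k = begin
    ∑ n (λ i → Y (d + j) i *ℤ pascal⁻¹ z i c) ≡⟨ ∑-cong n (λ i _ → cong (_*ℤ pascal⁻¹ z i c) (if-<-no (m≤m+n d j))) ⟩
    ∑ n (λ i → δ i (d + j) *ℤ pascal⁻¹ z i c) ≡⟨ ∑-δ n (d + j) (λ i → pascal⁻¹ z i c) (+-monoʳ-< d j<k) ⟩
    sgn (d + j + c) *ℤ N j c                  ≡⟨ cong (_*ℤ N j c) (sgn-+ (d + j) c) ⟩
    sgn (d + j) *ℤ sgn c *ℤ N j c             ≡⟨ ℤₚ.*-assoc (sgn (d + j)) (sgn c) (N j c) ⟩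
    sgn (d + j) *ℤ (sgn c *ℤ N j c)           ∎

-- Intervals

applyUpTo-++ : ∀ (f : ℕ → ℕ) m n → applyUpTo f (m + n) ≡ applyUpTo f m ++ applyUpTo (λ t → f (m + t)) n
applyUpTo-++ f zero    n = refl
applyUpTo-++ f (suc m) n = cong (f 0 ∷_) (applyUpTo-++ (f ∘ suc) m n)

interval-++ : ∀ x m n → interval x (m + n) ≡ interval x m ++ interval (x + m) n
interval-++ x m n = begin
  interval x (m + n)                                                  ≡⟨ map-upTo (λ t → x + t) (m + n) ⟩
  applyUpTo (λ t → x + t) (m + n)                                     ≡⟨ applyUpTo-++ (λ t → x + t) m n ⟩
  applyUpTo (λ t → x + t) m ++ applyUpTo (λ t → x + (m + t)) n        ≡⟨ cong₂ _++_ (map-upTo (λ t → x + t) m) (map-upTo (λ t → x + (m + t)) n) ⟨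
  interval x m ++ map (λ t → x + (m + t)) (upTo n)                    ≡⟨ cong (interval x m ++_) (map-cong (λ t → sym (+-assoc x m t)) (upTo n)) ⟩
  interval x m ++ interval (x + m) n                                  ∎

∈-interval⁺ : ∀ x {n t} → t < n → x + t ∈ interval x n
∈-interval⁺ x t<n = ∈-map⁺ (λ t → x + t) (∈-upTo⁺ t<n)

∉-interval : ∀ {x n y} → y < x ⊎ x + n ≤ y → y ∉ interval x n
∉-interval {x} {n} outside y∈ with ∈-map⁻ (λ t → x + t) y∈
... | t , t∈ , refl with outside
...   | inj₁ x+t<x  = <⇒≱ x+t<x (m≤m+n x t)
...   | inj₂ x+n≤x+t = <⇒≱ (∈-upTo⁻ t∈) (+-cancelˡ-≤ x n t x+n≤x+t)

interval-∖-disjoint : ∀ x n Y → (∀ {t} → t < n → x + t ∉ Y) → interval x n ∖ Y ≡ interval x n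
interval-∖-disjoint x n Y outside = filter-all (_∉? Y) (All.map⁺ (All.applyUpTo⁺₁ id n outside))

interval-∖-covered : ∀ x n Y → (∀ {t} → t < n → x + t ∈ Y) → interval x n ∖ Y ≡ []
interval-∖-covered x n Y inside = filter-none (_∉? Y) (All.map⁺ (All.applyUpTo⁺₁ id n (λ t<n x+t∉Y → x+t∉Y (inside t<n))))

interval-∖-apart : ∀ x y n → x + n ≤ y ⊎ y + n ≤ x → interval x n ∖ interval y n ≡ interval x n
interval-∖-apart x y n apart = interval-∖-disjoint x n (interval y n) λ {t} t<n → ∉-interval (outside t<n apart)
  where
  outside : ∀ {t} → t < n → x + n ≤ y ⊎ y + n ≤ x → x + t < y ⊎ y + n ≤ x + t
  outside t<n (inj₁ x+n≤y) = inj₁ (<-≤-trans (+-monoʳ-< x t<n) x+n≤y)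
  outside {t} _ (inj₂ y+n≤x) = inj₂ (≤-trans y+n≤x (m≤m+n x t))

interval-∖-overlap-head : ∀ x k m → interval x (k + m) ∖ interval (x + k) (k + m) ≡ interval x k
interval-∖-overlap-head x k m = begin
  interval x (k + m) ∖ J                       ≡⟨ cong (_∖ J) (interval-++ x k m) ⟩
  (interval x k ++ interval (x + k) m) ∖ J     ≡⟨ filter-++ (_∉? J) (interval x k) (interval (x + k) m) ⟩
  interval x k ∖ J ++ interval (x + k) m ∖ J   ≡⟨ cong₂ _++_ head tail ⟩
  interval x k ++ []                           ≡⟨ ++-identityʳ (interval x k) ⟩
  interval x k                                 ∎
  where
  J = interval (x + k) (k + m)
  head = interval-∖-disjoint x k J λ t<k → ∉-interval (inj₁ (+-monoʳ-< x t<k))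
  tail = interval-∖-covered (x + k) m J λ t<m → ∈-interval⁺ (x + k) (<-≤-trans t<m (m≤n+m m k))

interval-∖-overlap-tail : ∀ x k m → interval (x + k) (k + m) ∖ interval x (k + m) ≡ interval (x + k + m) k
interval-∖-overlap-tail x k m = begin
  interval (x + k) (k + m) ∖ I                          ≡⟨ cong (λ n → interval (x + k) n ∖ I) (+-comm k m) ⟩
  interval (x + k) (m + k) ∖ I                          ≡⟨ cong (_∖ I) (interval-++ (x + k) m k) ⟩
  (interval (x + k) m ++ interval (x + k + m) k) ∖ I    ≡⟨ filter-++ (_∉? I) (interval (x + k) m) (interval (x + k + m) k) ⟩
  interval (x + k) m ∖ I ++ interval (x + k + m) k ∖ I  ≡⟨ cong₂ _++_ head tail ⟩
  [] ++ interval (x + k + m) k                          ∎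
  where
  I = interval x (k + m)
  head = interval-∖-covered (x + k) m I λ {t} t<m →
    subst (_∈ I) (sym (+-assoc x k t)) (∈-interval⁺ x (+-monoʳ-< k t<m))
  tail = interval-∖-disjoint (x + k + m) k I λ {t} _ →
    ∉-interval (inj₂ (subst (_≤ x + k + m + t) (+-assoc x k m) (m≤m+n (x + k + m) t)))

-- Binomial determinants on intervals

bDetInterval : ℕ → ℕ → ℕ → ℤ
bDetInterval x y n = detℕ n (λ r c → b (x + r) (y + c))

bDet-interval : ∀ {I J} x y n (e : length I ≡ length J) → I ≡ interval x n → J ≡ interval y n →
  bDet I J e ≡ bDetInterval x y n
bDet-interval {I} {J} x y n e I≡ J≡ = begin
  bDet I J e                     ≡⟨ det≡detℕ (length I) _ M entries ⟩
  detℕ (length I) M              ≡⟨ cong (λ m → detℕ m M) (trans (cong length I≡f) (length-applyUpTo f n)) ⟩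
  bDetInterval x y n             ∎
  where
  f g : ℕ → ℕ
  f r = x + r
  g c = y + c
  M : Matrix
  M r c = b (f r) (g c)
  I≡f : I ≡ applyUpTo f n
  I≡f = trans I≡ (map-upTo f n)
  J≡g : J ≡ applyUpTo g n
  J≡g = trans J≡ (map-upTo g n)
  lookup-≡ : ∀ {L} h (L≡ : L ≡ applyUpTo h n) i → lookup L i ≡ h (toℕ i)
  lookup-≡ h refl i = lookup-applyUpTo h n i
  entries : ∀ r c → b (lookup I r) (lookup J (Fin.cast e c)) ≡ M (toℕ r) (toℕ c)
  entries r c = cong₂ b (lookup-≡ f I≡f r) (trans (lookup-≡ g J≡g (Fin.cast e c)) (cong g (toℕ-cast e c)))

bDetInterval-vanishes : ∀ {x y} n → x < y → 0 < n → bDetInterval x y n ≡ + 0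
bDetInterval-vanishes {x} {y} (suc n) x<y _ = detℕ-zero-row (suc n) 0 (λ r c → b (x + r) (y + c)) (s≤s z≤n) λ c _ →
  cong +_ (k>n⇒nCk≡0 (<-≤-trans (subst (_< y) (sym (+-identityʳ x)) x<y) (m≤m+n y c)))

bDetInterval-duality : ∀ z k d → bDetInterval (z + k) z d ≡ bDetInterval (z + d) z k
bDetInterval-duality z k d = begin
  bDetInterval (z + k) z d          ≡⟨ detℕ-cong d (λ r c _ _ → cong (λ p → b p (z + c)) (+-assoc z k r)) ⟩
  detℕ d (λ r → pascal z (k + r))   ≡⟨ pascal-minor-duality z k d ⟩
  detℕ k (λ r → pascal z (d + r))   ≡⟨ detℕ-cong k (λ r c _ _ → cong (λ p → b p (z + c)) (+-assoc z d r)) ⟨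
  bDetInterval (z + d) z k          ∎

data Placement : ℕ → ℕ → ℕ → Set where
  apart    : ∀ {D i j} → i + D ≤ j ⊎ j + D ≤ i → Placement D i j
  overlapˡ : ∀ x k m → 0 < k → Placement (k + m) x (x + k)
  overlapʳ : ∀ x k m → Placement (k + m) (x + k) x

placement : ∀ D i j → Placement D i j
placement D i j with j ≤? i
... | yes j≤i with k , refl ← m≤n⇒∃[o]m+o≡n j≤i with k ≤? D
...   | yes k≤D with m , refl ← m≤n⇒∃[o]m+o≡n k≤D = overlapʳ j k m
...   | no  k≰D = apart (inj₂ (+-monoʳ-≤ j (<⇒≤ (≰⇒> k≰D))))
placement D i j | no j≰i with k , refl ← m≤n⇒∃[o]m+o≡n (<⇒≤ (≰⇒> j≰i)) with k ≤? D
...   | yes k≤D with m , refl ← m≤n⇒∃[o]m+o≡n k≤D = overlapˡ i k m (+-cancelˡ-< i 0 k (subst (_< i + k) (sym (+-identityʳ i)) (≰⇒> j≰i)))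
...   | no  k≰D = apart (inj₁ (+-monoʳ-≤ i (<⇒≤ (≰⇒> k≰D))))

MinorIdentity : ℕ → ℕ → ℕ → Set
MinorIdentity D i j =
  Σ (length (interval i D ∖ interval j D) ≡ length (interval j D ∖ interval i D))
    (λ e → bDet (interval i D) (interval j D) (interval-len i j D)
         ≡ bDet (interval i D ∖ interval j D) (interval j D ∖ interval i D) e)

minorIdentity-via : ∀ D i j x y n → interval i D ∖ interval j D ≡ interval x n → interval j D ∖ interval i D ≡ interval y n →
  bDetInterval i j D ≡ bDetInterval x y n → MinorIdentity D i j
minorIdentity-via D i j x y n I∖J≡ J∖I≡ eq = e , (begin
  bDet I J (interval-len i j D) ≡⟨ bDet-interval i j D (interval-len i j D) refl refl ⟩
  bDetInterval i j D           ≡⟨ eq ⟩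
  bDetInterval x y n           ≡⟨ bDet-interval x y n e I∖J≡ J∖I≡ ⟨
  bDet (I ∖ J) (J ∖ I) e       ∎)
  where
  I = interval i D
  J = interval j D
  e : length (I ∖ J) ≡ length (J ∖ I)
  e = trans (cong length I∖J≡) (trans (interval-len x y n) (cong length (sym J∖I≡)))

minorIdentity : ∀ {D i j} → Placement D i j → MinorIdentity D i j
minorIdentity {D} {i} {j} (apart h) =
  minorIdentity-via D i j i j D (interval-∖-apart i j D h) (interval-∖-apart j i D (Sum.swap h)) refl
minorIdentity (overlapˡ x k m 0<k) =
  minorIdentity-via (k + m) x (x + k) x (x + k + m) k (interval-∖-overlap-head x k m) (interval-∖-overlap-tail x k m) (begin
    bDetInterval x (x + k) (k + m)   ≡⟨ bDetInterval-vanishes (k + m) x<x+k (<-≤-trans 0<k (m≤m+n k m)) ⟩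
    + 0                              ≡⟨ bDetInterval-vanishes k (<-≤-trans x<x+k (m≤m+n (x + k) m)) 0<k ⟨
    bDetInterval x (x + k + m) k     ∎)
  where x<x+k = subst (_< x + k) (+-identityʳ x) (+-monoʳ-< x 0<k)
minorIdentity (overlapʳ x k m) =
  minorIdentity-via (k + m) (x + k) x (x + k + m) x k (interval-∖-overlap-tail x k m) (interval-∖-overlap-head x k m)
    (trans (bDetInterval-duality x k (k + m)) (cong (λ p → bDetInterval p x k) (sym (+-assoc x k m))))

corollary4p6 : (d' i j : ℕ) →
    Σ (length (interval i (suc d') ∖ interval j (suc d')) ≡ length (interval j (suc d') ∖ interval i (suc d')))
      (λ e → bDet (interval i (suc d')) (interval j (suc d')) (interval-len i j (suc d'))
             ≡ bDet (interval i (suc d') ∖ interval j (suc d')) (interval j (suc d') ∖ interval i (suc d')) e)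
corollary4p6 d' i j = minorIdentity (placement (suc d') i j)
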